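{- Inductive branch width is equivalent to branch width: for every hypergraph with sources $\Gamma=(G,X)$, \[\mathrm{bwd}(G)\le\mathrm{ibwd}(\Gamma)\le\mathrm{bwd}(G)+|X|.\]
   Context: A hypergraph $G=(V,E,\mathrm{ends})$ has finite sets $V,E$ and $\mathrm{ends}\colon E\to\mathcal P(V)$; for $S\subseteq E$ write $\mathrm{ends}(S)=\bigcup_{e\in S}\mathrm{ends}(e)$. A subhypergraph is $(V',E',\mathrm{ends}|_{E'})$ with $V'\subseteq V$, $E'\subseteq E$, $\mathrm{ends}(E')\subseteq V'$. Branch width: a branch decomposition of $G$ is $(Y,b)$ with $Y$ a tree whose vertices have at most three neighbours and $b$ a bijection from the leaves of $Y$ (vertices of degree $\le1$) to $E$. An edge $e$ of $Y$ induces a partition $\{A_e,B_e\}$ of $E$; its order is $|\mathrm{ends}(A_e)\cap\mathrm{ends}(B_e)|$. The width of $(Y,b)$ is the maximum order of an edge of $Y$ (0 if none); $\mathrm{bwd}(G)$ is the minimum width. Hypergraph with sources: $\Gamma=(G,X)$ with $X\subseteq V$; $(G',X')$ is a subhypergraph of $\Gamma$ if $G'$ is a subhypergraph of $G$ ($X'$ any subset of the vertices of $G'$). An inductive branch decomposition of $\Gamma=((V,E,\mathrm{ends}),X)$ is a binary tree whose nodes are labelled by subhypergraphs with sources of $\Gamma$, defined as: (a) the empty tree, if $E=\emptyset$; (b) a single leaf labelled $\Gamma$, if $|E|=1$; (c) a root labelled $\Gamma$ with subtrees $T_1,T_2$, where $T_i$ is an inductive branch decomposition of a subhypergraph $\Gamma_i=((V_i,E_i,\mathrm{ends}|_{E_i}),X_i)$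 with $E=E_1\sqcup E_2$, $V=V_1\cup V_2$ and $X_i=(V_1\cap V_2)\cup(X\cap V_i)$. Width: the empty tree has width 0; a tree with root label $(G',X')$ and subtrees $T_1,T_2$ (both empty for a leaf) has width $\max\{\mathrm{wd}(T_1),\mathrm{wd}(T_2),|X'|\}$. $\mathrm{ibwd}(\Gamma)$ is the minimum width of an inductive branch decomposition of $\Gamma$. -}

module Defs where

open import Data.Nat using (ℕ; zero; suc; _≤_; _⊔_; NonZero)
open import Data.Fin using (Fin)
open import Data.Fin.Subset using (Subset; _∈_; _⊆_; ∣_∣; _∩_; _∪_) renaming (⊥ to ∅; ⊤ to full)
open import Data.List using (List; _∷_; []; _++_; length)
open import Data.List.Relation.Unary.Linked using (Linked)
open import Data.List.Relation.Unary.Unique.Propositional using (Unique)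
open import Data.Product using (Σ; ∃; _×_; proj₁)
open import Data.Sum using (_⊎_)
open import Relation.Nullary using (¬_)
open import Relation.Binary.PropositionalEquality using (_≡_)
open import Relation.Binary.Construct.Closure.ReflexiveTransitive using (Star)
open import Function.Bundles using (_↔_; _⇔_; Inverse)

record Hypergraph : Set where
  field
    n    : ℕ
    m    : ℕ
    ends : Fin m → Subset n

open Hypergraph public

record SimpleGraph (p : ℕ) : Set where
  field
    nbr       : Fin p → Subset p
    symmetric : ∀ u v → v ∈ nbr u → u ∈ nbr v
    irrefl    : ∀ v → ¬ (v ∈ nbr v)

  Adj : Fin p → Fin p → Set
  Adj u v = v ∈ nbr u

  degree : Fin p → ℕ
  degree v = ∣ nbr v ∣

  Connected : Set
  Connected = ∀ u v → Star Adj u v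

  HasCycle : Set
  HasCycle = Σ (Fin p) λ x → Σ (List (Fin p)) λ rest →
               (2 ≤ length rest) × Unique (x ∷ rest) × Linked Adj (x ∷ rest ++ (x ∷ []))

  IsTree : Set
  IsTree = NonZero p × Connected × ¬ HasCycle

  IsLeaf : Fin p → Set
  IsLeaf v = degree v ≤ 1

record BranchDecomposition (G : Hypergraph) : Set where
  field
    p       : ℕ
    Y       : SimpleGraph p
  open SimpleGraph Y public
  field
    isTree    : IsTree
    subcubic  : ∀ v → degree v ≤ 3
    b         : Σ (Fin p) IsLeaf ↔ Fin (m G)

  leafOf : Fin (m G) → Fin p
  leafOf e = proj₁ (Inverse.from b e)

  AdjWithout : Fin p → Fin p → Fin p → Fin p → Set
  AdjWithout u v x y = Adj x y × ¬ ((x ≡ u × y ≡ v) ⊎ (x ≡ v × y ≡ u))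

  -- A_e for e = {u,v}: edges of G whose leaf lies in the component of u
  -- in Y - uv ; B_e is its complement in E
  InA : Fin p → Fin p → Fin (m G) → Set
  InA u v e = Star (AdjWithout u v) u (leafOf e)

  Cut : Fin p → Fin p → Fin (n G) → Set
  Cut u v x = (∃ λ e → InA u v e × x ∈ ends G e)
            × (∃ λ e → ¬ InA u v e × x ∈ ends G e)

  WidthLE : ℕ → Set
  WidthLE k = ∀ u v → Adj u v → (S : Subset (n G)) →
              (∀ x → (x ∈ S) ⇔ Cut u v x) → ∣ S ∣ ≤ k

open BranchDecomposition public using (WidthLE)

-- bwd(G) = b : b is the minimum width of a branch decomposition
-- (convention: bwd = 0 for a hypergraph with no edges, which has none)
IsBwd : Hypergraph → ℕ → Set
IsBwd G b = (∀ (D : BranchDecomposition G) c → WidthLE D c → b ≤ c)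
          × ((Σ (BranchDecomposition G) λ D → WidthLE D b) ⊎ (m G ≡ 0 × b ≡ 0))

-- Inductive branch decompositions. Subhypergraphs with sources of
-- Γ = (G, X) are given by (V', E', X') ⊆ V × E × V.

module _ (G : Hypergraph) where

  data IBD : Subset (n G) → Subset (m G) → Subset (n G) → Set where
    empty : ∀ {V E X} → E ≡ ∅ → IBD V E X
    leaf  : ∀ {V E X} → ∣ E ∣ ≡ 1 → IBD V E X
    node  : ∀ {V E X} V₁ E₁ V₂ E₂ →
            (∀ e → e ∈ E₁ → ends G e ⊆ V₁) →
            (∀ e → e ∈ E₂ → ends G e ⊆ V₂) →
            E₁ ∩ E₂ ≡ ∅ → E₁ ∪ E₂ ≡ E → V₁ ∪ V₂ ≡ V →
            IBD V₁ E₁ ((V₁ ∩ V₂) ∪ (X ∩ V₁)) →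
            IBD V₂ E₂ ((V₁ ∩ V₂) ∪ (X ∩ V₂)) →
            IBD V E X

  wd : ∀ {V E X} → IBD V E X → ℕ
  wd (empty _) = 0
  wd {X = X} (leaf _) = ∣ X ∣
  wd {X = X} (node _ _ _ _ _ _ _ _ _ t₁ t₂) = wd t₁ ⊔ wd t₂ ⊔ ∣ X ∣

  IsIbwd : Subset (n G) → ℕ → Set
  IsIbwd X i = (Σ (IBD full full X) λ T → wd T ≡ i)
             × (∀ (T : IBD full full X) → i ≤ wd T)

-- A branch decomposition (Y, b) of width β gives an inductive one of width at most β + ∣X∣: root Y
-- at a leaf and label the node for a tree edge uv (u nearer the root) by the set A of edges whose
-- leaves lie beyond v, their ends, and sources inside border A ∪ X, where
-- border A = ends(A) ∩ ends(E ∖ A) has the order of uv as its size. Conversely, in an inductive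
-- decomposition of (G, X) every vertex of a node lying on an edge outside the node is a source, so
-- the sources of a node with edges A contain border A; keeping only the edge sets leaves a binary
-- tree whose leaves are the edges of G, i.e. a branch decomposition, and its orders are these borders.

module Submission where

open import Defs
open import Level using (Level)
open import Data.Nat using (ℕ; zero; suc; _≤_; _<_; _+_; z≤n; s≤s; NonZero)
open import Data.Nat.Properties
  using (≤-trans; ≤-refl; ≤-reflexive; ≤-irrelevant; +-suc; n≤1+n; +-mono-≤; +-monoˡ-≤;
         +-identityʳ; ⊔-lub; m≤m⊔n; m≤n⊔m; m≤n+m; module ≤-Reasoning)
open import Data.Bool using (true; false)
open import Data.Fin using (Fin; zero; suc; _↑ˡ_; _↑ʳ_; splitAt)
open import Data.Fin.Properties
  using (any?; ¬Fin0; splitAt-↑ˡ; splitAt-↑ʳ; splitAt⁻¹-↑ˡ; splitAt⁻¹-↑ʳ) renaming (_≟_ to _≟ᶠ_)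
open import Data.Fin.Subset
  using (Subset; _∈_; _∉_; _⊆_; ∣_∣; _∩_; _∪_; ∁; ⁅_⁆; _-_)
  renaming (⊥ to ∅; ⊤ to full)
open import Data.Fin.Subset.Properties
  using (_∈?_; ∈⊤; ∉⊥; ∣⊤∣≡n; ∣⊥∣≡0; ∣⁅x⁆∣≡1; ∣p∣≤n; x∈⁅x⁆; x∈⁅y⁆⇒x≡y; x∈p∪q⁺; x∈p∪q⁻;
         x∈p∩q⁺; x∈p∩q⁻; x∈p∧x≢y⇒x∈p-y; x∈p⇒∣p-x∣<∣p∣; x∉∁p⇒x∈p; x∈∁p⇒x∉p; x∉p⇒x∈∁p;
         p⊆q⇒∣p∣≤∣q∣; p⊂q⇒∣p∣<∣q∣; p⊆p∪q; q⊆p∪q; ⊆-antisym; Empty-unique;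
         ∩-comm; ∪-comm; ∪-identityˡ; ∪-identityʳ)
open import Data.Vec using ([]; _∷_; tabulate)
open import Data.Vec.Properties using (lookup∘tabulate; []=⇒lookup; lookup⇒[]=)
open import Data.List using (List; []; _∷_; length; _++_; fromMaybe)
open import Data.List.Properties using (length-map; length-++)
open import Data.Maybe using (Maybe; just; nothing; maybe′)
open import Data.List.Relation.Unary.All using (All; []; _∷_)
import Data.List.Relation.Unary.All as All
import Data.List.Relation.Unary.All.Properties as All++
open import Data.List.Relation.Unary.AllPairs using ([]; _∷_)
open import Data.List.Relation.Unary.Any using (here; there)
open import Data.List.Relation.Unary.Linked using (Linked; [-]; _∷_)
open import Data.List.Relation.Unary.Unique.Propositional using (Unique)
open import Data.List.Membership.Propositional using () renaming (_∈_ to _∈ₗ_)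
open import Data.List.Membership.Propositional.Properties using (∈-map⁺; ∈-++⁺ʳ)
open import Data.Product using (Σ; ∃; ∃₂; _×_; _,_; proj₁; proj₂; uncurry)
open import Data.Sum using (_⊎_; inj₁; inj₂; [_,_]′)
open import Data.Empty using (⊥; ⊥-elim)
open import Data.Unit using (⊤; tt)
open import Relation.Nullary using (Dec; yes; no; does; ¬_)
open import Relation.Nullary.Decidable using (_×-dec_; _⊎-dec_; ¬?; dec-true)
open import Relation.Unary using (Decidable)
open import Relation.Binary.Construct.Closure.ReflexiveTransitive using (Star; ε; _◅_; _◅◅_)
import Relation.Binary.Construct.Closure.ReflexiveTransitive as Star
open import Function.Bundles using (_⇔_; mk⇔; Equivalence; Inverse; _↔_; mk↔ₛ′)
open import Relation.Binary.PropositionalEquality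
  using (_≡_; _≢_; refl; sym; trans; cong; subst; subst₂)

private
  variable
    ℓ : Level
    k : ℕ

module _ {P : Fin k → Set ℓ} (P? : Decidable P) where

  select : Subset k
  select = tabulate (λ x → does (P? x))

  ∈-select⁺ : ∀ {x} → P x → x ∈ select
  ∈-select⁺ {x} px = lookup⇒[]= x select (trans (lookup∘tabulate _ x) (dec-true (P? x) px))

  ∈-select⁻ : ∀ {x} → x ∈ select → P x
  ∈-select⁻ {x} x∈ = witness (P? x) (trans (sym (lookup∘tabulate _ x)) ([]=⇒lookup x∈))
    where
    witness : (a? : Dec (P x)) → does a? ≡ true → P x
    witness (yes a) _ = a

∣p∪q∣≤∣p∣+∣q∣ : (p q : Subset k) → ∣ p ∪ q ∣ ≤ ∣ p ∣ + ∣ q ∣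
∣p∪q∣≤∣p∣+∣q∣ [] [] = z≤n
∣p∪q∣≤∣p∣+∣q∣ (true ∷ p) (true ∷ q) =
  s≤s (≤-trans (∣p∪q∣≤∣p∣+∣q∣ p q) (≤-trans (n≤1+n _) (≤-reflexive (sym (+-suc _ _)))))
∣p∪q∣≤∣p∣+∣q∣ (true ∷ p) (false ∷ q) = s≤s (∣p∪q∣≤∣p∣+∣q∣ p q)
∣p∪q∣≤∣p∣+∣q∣ (false ∷ p) (true ∷ q) =
  ≤-trans (s≤s (∣p∪q∣≤∣p∣+∣q∣ p q)) (≤-reflexive (sym (+-suc _ _)))
∣p∪q∣≤∣p∣+∣q∣ (false ∷ p) (false ∷ q) = ∣p∪q∣≤∣p∣+∣q∣ p q

length≤∣∣ : ∀ {L : List (Fin k)} {S} → Unique L → All (_∈ S) L → length L ≤ ∣ S ∣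
length≤∣∣ [] [] = z≤n
length≤∣∣ {S = S} (x∉L ∷ L!) (x∈S ∷ L⊆S) =
  ≤-trans (s≤s (length≤∣∣ L! (remove x∉L L⊆S))) (x∈p⇒∣p-x∣<∣p∣ x∈S)
  where
  remove : ∀ {x} {L : List _} → All (x ≢_) L → All (_∈ S) L → All (_∈ S - x) L
  remove [] [] = []
  remove (x≢y ∷ x≢L) (y∈S ∷ L⊆S) = x∈p∧x≢y⇒x∈p-y y∈S (λ y≡x → x≢y (sym y≡x)) ∷ remove x≢L L⊆S

fromList : List (Fin k) → Subset k
fromList [] = ∅
fromList (x ∷ L) = ⁅ x ⁆ ∪ fromList L

∈-fromList⁺ : ∀ {x : Fin k} {L} → x ∈ₗ L → x ∈ fromList L
∈-fromList⁺ {x = x} (here refl) = x∈p∪q⁺ (inj₁ (x∈⁅x⁆ x))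
∈-fromList⁺ (there x∈L) = x∈p∪q⁺ (inj₂ (∈-fromList⁺ x∈L))

∣fromList∣≤length : (L : List (Fin k)) → ∣ fromList L ∣ ≤ length L
∣fromList∣≤length {k} [] = ≤-reflexive (∣⊥∣≡0 k)
∣fromList∣≤length (x ∷ L) =
  ≤-trans (∣p∪q∣≤∣p∣+∣q∣ ⁅ x ⁆ (fromList L)) (+-mono-≤ (≤-reflexive (∣⁅x⁆∣≡1 x)) (∣fromList∣≤length L))

∣p∣≡1⇒singleton : {p : Subset k} → ∣ p ∣ ≡ 1 → ∃ λ x → p ≡ ⁅ x ⁆
∣p∣≡1⇒singleton {p = true ∷ p} ∣p∣≡1 = zero , cong (true ∷_) (∣p∣≡0⇒p≡∅ p (cong Data.Nat.pred ∣p∣≡1))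
  where
  ∣p∣≡0⇒p≡∅ : ∀ {k} (p : Subset k) → ∣ p ∣ ≡ 0 → p ≡ ∅
  ∣p∣≡0⇒p≡∅ [] _ = refl
  ∣p∣≡0⇒p≡∅ (false ∷ p) ∣p∣≡0 = cong (false ∷_) (∣p∣≡0⇒p≡∅ p ∣p∣≡0)
∣p∣≡1⇒singleton {p = false ∷ p} ∣p∣≡1 with ∣p∣≡1⇒singleton {p = p} ∣p∣≡1
... | x , refl = suc x , refl

unique-∷ʳ⁻ : ∀ {A : Set} (l : List A) {x} → Unique (l ++ x ∷ []) → All (x ≢_) l × Unique l
unique-∷ʳ⁻ [] _ = [] , []
unique-∷ʳ⁻ (y ∷ l) (y∉ ∷ l!) with All++.++⁻ l y∉ | unique-∷ʳ⁻ l l!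
... | y∉l , (y≢x ∷ []) | x∉l , l!′ = (λ x≡y → y≢x (sym x≡y)) ∷ x∉l , y∉l ∷ l!′

disjoint⇒∩≡∅ : {p q : Subset k} → (∀ {x} → x ∈ p → x ∈ q → ⊥) → p ∩ q ≡ ∅
disjoint⇒∩≡∅ {p = p} {q} disjoint =
  ⊆-antisym (λ x∈ → ⊥-elim (uncurry disjoint (x∈p∩q⁻ p q x∈))) (λ x∈ → ⊥-elim (∉⊥ x∈))

∩≡∅⇒disjoint : {p q : Subset k} → p ∩ q ≡ ∅ → ∀ {x} → x ∈ p → x ∈ q → ⊥
∩≡∅⇒disjoint p∩q≡∅ x∈p x∈q = ∉⊥ (subst (_ ∈_) p∩q≡∅ (x∈p∩q⁺ (x∈p , x∈q)))

star-reflect : ∀ {A B : Set} {S : A → A → Set} {T : B → B → Set} (f : A → B) (g : B → A) →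
               (∀ a → g (f a) ≡ a) → (∀ b → f (g b) ≡ b) → (∀ {a b} → T (f a) (f b) → S a b) →
               ∀ {a b} → Star T (f a) (f b) → Star S a b
star-reflect {S = S} {T} f g g∘f f∘g T⇒S {a} {b} walk =
  subst₂ (Star S) (g∘f a) (g∘f b)
    (Star.gmap g (λ {x} {y} r → T⇒S (subst₂ T (sym (f∘g x)) (sym (f∘g y)) r)) walk)

module Walks {p : ℕ} (R : Fin p → Fin p → Set) where

  open import Data.List.Membership.DecPropositional (_≟ᶠ_ {p}) using () renaming (_∈?_ to _∈ₗ?_)

  vertices : ∀ {a b} → Star R a b → List (Fin p)
  vertices {a} ε = a ∷ []
  vertices {a} (_ ◅ w) = a ∷ vertices w

  initial : ∀ {a b} → Star R a b → List (Fin p)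
  initial ε = []
  initial {a} (_ ◅ w) = a ∷ initial w

  vertices≡initial++last : ∀ {a b} (w : Star R a b) → vertices w ≡ initial w ++ b ∷ []
  vertices≡initial++last ε = refl
  vertices≡initial++last {a} (_ ◅ w) = cong (a ∷_) (vertices≡initial++last w)

  Simple : ∀ {a b} → Star R a b → Set
  Simple w = Unique (vertices w)

  suffixFrom : ∀ {a c b} (w : Star R c b) → Simple w → a ∈ₗ vertices w → Σ (Star R a b) Simple
  suffixFrom ε w! (here refl) = ε , w!
  suffixFrom (r ◅ w) w! (here refl) = r ◅ w , w!
  suffixFrom (_ ◅ w) (_ ∷ w!) (there a∈) = suffixFrom w w! a∈

  simplify : ∀ {a b} → Star R a b → Σ (Star R a b) Simple
  simplify ε = ε , [] ∷ []
  simplify {a} (r ◅ w) with simplify w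
  ... | w′ , w′! with a ∈ₗ? vertices w′
  ...   | yes a∈ = suffixFrom w′ w′! a∈
  ...   | no a∉ = r ◅ w′ , All.tabulate (λ y∈ a≡y → a∉ (subst (_∈ₗ vertices w′) (sym a≡y) y∈)) ∷ w′!

  module _ (R? : ∀ x y → Dec (R x y)) where

    within : ℕ → Fin p → Subset p
    within zero a = ⁅ a ⁆
    within (suc k) a = ⁅ a ⁆ ∪ select (λ y → any? (λ x → R? a x ×-dec y ∈? within k x))

    ∈-within : ∀ k a → a ∈ within k a
    ∈-within zero a = x∈⁅x⁆ a
    ∈-within (suc k) a = x∈p∪q⁺ (inj₁ (x∈⁅x⁆ a))

    within-sound : ∀ k {a y} → y ∈ within k a → Star R a y
    within-sound zero {a} y∈ = subst (Star R a) (sym (x∈⁅y⁆⇒x≡y a y∈)) ε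
    within-sound (suc k) {a} y∈ with x∈p∪q⁻ _ _ y∈
    ... | inj₁ y∈⁅a⁆ = subst (Star R a) (sym (x∈⁅y⁆⇒x≡y a y∈⁅a⁆)) ε
    ... | inj₂ y∈step with ∈-select⁻ (λ y → any? (λ x → R? a x ×-dec y ∈? within k x)) y∈step
    ...   | _ , r , y∈′ = r ◅ within-sound k y∈′

    within-complete : ∀ k {a y} (w : Star R a y) → length (vertices w) ≤ suc k → y ∈ within k a
    within-complete k {a} ε _ = ∈-within k a
    within-complete zero (_ ◅ ε) (s≤s ())
    within-complete zero (_ ◅ _ ◅ _) (s≤s ())
    within-complete (suc k) {y = y} (r ◅ w) (s≤s ∣w∣≤) =
      x∈p∪q⁺ (inj₂ (∈-select⁺ (λ y → any? (λ x → R? _ x ×-dec y ∈? within k x))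
                              (_ , r , within-complete k w ∣w∣≤)))

    reachable? : ∀ a y → Dec (Star R a y)
    reachable? a y = Relation.Nullary.Decidable.map′ (within-sound p) complete (y ∈? within p a)
      where
      complete : Star R a y → y ∈ within p a
      complete w with simplify w
      ... | w′ , w′! = within-complete p w′
        (≤-trans (length≤∣∣ w′! (All.tabulate (λ _ → ∈⊤))) (≤-trans (≤-reflexive (∣⊤∣≡n p)) (n≤1+n p)))

module Graph {p : ℕ} (Y : SimpleGraph p) where

  open SimpleGraph Y
  open import Data.List.Membership.DecPropositional (_≟ᶠ_ {p}) using () renaming (_∈?_ to _∈ₗ?_)

  adj? : ∀ u v → Dec (Adj u v)
  adj? u v = v ∈? nbr u

  Without : Fin p → Fin p → Fin p → Fin p → Set
  Without u v x y = Adj x y × ¬ ((x ≡ u × y ≡ v) ⊎ (x ≡ v × y ≡ u))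

  without? : ∀ u v x y → Dec (Without u v x y)
  without? u v x y = adj? x y ×-dec ¬? (((x ≟ᶠ u) ×-dec (y ≟ᶠ v)) ⊎-dec ((x ≟ᶠ v) ×-dec (y ≟ᶠ u)))

  without-reverse : ∀ {u v x y} → Without u v x y → Without u v y x
  without-reverse {x = x} {y} (xy , ¬uv) =
    symmetric x y xy , λ { (inj₁ (y≡u , x≡v)) → ¬uv (inj₂ (x≡v , y≡u))
                         ; (inj₂ (y≡v , x≡u)) → ¬uv (inj₁ (x≡u , y≡v)) }

  without-swap : ∀ {u v x y} → Without u v x y → Without v u x y
  without-swap (xy , ¬uv) = xy , λ { (inj₁ e) → ¬uv (inj₂ e) ; (inj₂ e) → ¬uv (inj₁ e) }

  Beyond : Fin p → Fin p → Fin p → Set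
  Beyond u v = Star (Without v u) v

  beyond? : ∀ u v y → Dec (Beyond u v y)
  beyond? u v = Walks.reachable? (Without v u) (without? v u) v

  first-step : ∀ {x y} → Star Adj x y → x ≢ y → ∃ (Adj x)
  first-step ε x≢x = ⊥-elim (x≢x refl)
  first-step (xz ◅ _) _ = _ , xz

  edge-sides : Connected → ∀ u v y → Beyond v u y ⊎ Beyond u v y
  edge-sides connected u v y = go (inj₁ ε) (connected u y)
    where
    extend : ∀ {a c} → Beyond v u a ⊎ Beyond u v a → Adj a c → Beyond v u c ⊎ Beyond u v c
    extend {a} {c} side ac with c ≟ᶠ u | c ≟ᶠ v
    ... | yes refl | _ = inj₁ ε
    ... | no _ | yes refl = inj₂ ε
    ... | no c≢u | no c≢v with side
    ...   | inj₁ w = inj₁ (w ◅◅ ((ac , λ { (inj₁ (_ , c≡v)) → c≢v c≡v ; (inj₂ (_ , c≡u)) → c≢u c≡u }) ◅ ε))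
    ...   | inj₂ w = inj₂ (w ◅◅ ((ac , λ { (inj₁ (_ , c≡u)) → c≢u c≡u ; (inj₂ (_ , c≡v)) → c≢v c≡v }) ◅ ε))
    go : ∀ {a y} → Beyond v u a ⊎ Beyond u v a → Star Adj a y → Beyond v u y ⊎ Beyond u v y
    go side ε = side
    go side (ac ◅ w) = go (extend side ac) w

  cycle⇒non-bridge : HasCycle → ∃₂ λ u v → Adj u v × Beyond u v u
  cycle⇒non-bridge (x , [] , () , _)
  cycle⇒non-bridge (x , v ∷ [] , s≤s () , _)
  cycle⇒non-bridge (x , v ∷ w ∷ vs , _ , ((x≢v ∷ x≢rest) ∷ v≢rest ∷ _) , (xv ∷ vw ∷ cycle)) =
    x , v , xv , (vw , leaving-v) ◅ around vs x≢rest v≢rest cycle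
    where
    leaving-v : ¬ ((v ≡ v × w ≡ x) ⊎ (v ≡ x × w ≡ v))
    leaving-v (inj₁ (_ , w≡x)) = All.head x≢rest (sym w≡x)
    leaving-v (inj₂ (v≡x , _)) = x≢v (sym v≡x)
    step : ∀ {a b} → x ≢ a → v ≢ a → Adj a b → Without v x a b
    step x≢a v≢a ab = ab , λ { (inj₁ (a≡v , _)) → v≢a (sym a≡v) ; (inj₂ (a≡x , _)) → x≢a (sym a≡x) }
    around : ∀ {a} l → All (x ≢_) (a ∷ l) → All (v ≢_) (a ∷ l) → Linked Adj (a ∷ l ++ x ∷ []) →
             Star (Without v x) a x
    around [] (x≢a ∷ []) (v≢a ∷ []) (ax ∷ [-]) = step x≢a v≢a ax ◅ ε
    around (b ∷ l) (x≢a ∷ x≢l) (v≢a ∷ v≢l) (ab ∷ path) = step x≢a v≢a ab ◅ around l x≢l v≢l path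

  data OtherNeighbours (v u : Fin p) : Set where
    none : (∀ {z} → Adj v z → z ∈ₗ u ∷ []) → OtherNeighbours v u
    one  : ∀ w → Adj v w → w ≢ u → (∀ {z} → Adj v z → z ∈ₗ u ∷ w ∷ []) → OtherNeighbours v u
    two  : ∀ w₁ w₂ → Adj v w₁ → Adj v w₂ → w₁ ≢ u → w₂ ≢ u → w₁ ≢ w₂ →
           (∀ {z} → Adj v z → z ∈ₗ u ∷ w₁ ∷ w₂ ∷ []) → OtherNeighbours v u

  neighbourOutside? : ∀ v (S : List (Fin p)) → Dec (∃ λ z → Adj v z × All (z ≢_) S)
  neighbourOutside? v S = any? (λ z → adj? v z ×-dec All.all? (λ y → ¬? (z ≟ᶠ y)) S)

  neighbours⊆ : ∀ {v} S → ¬ (∃ λ z → Adj v z × All (z ≢_) S) → ∀ {z} → Adj v z → z ∈ₗ S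
  neighbours⊆ S noneOutside {z} vz with z ∈ₗ? S
  ... | yes z∈S = z∈S
  ... | no z∉S = ⊥-elim (noneOutside (z , vz , All.tabulate (λ y∈S z≡y → z∉S (subst (_∈ₗ S) (sym z≡y) y∈S))))

  otherNeighbours : ∀ {v u} → Adj v u → degree v ≤ 3 → OtherNeighbours v u
  otherNeighbours {v} {u} vu deg with neighbourOutside? v (u ∷ [])
  ... | no noneOutside = none (neighbours⊆ _ noneOutside)
  ... | yes (w₁ , vw₁ , w₁≢u ∷ []) with neighbourOutside? v (u ∷ w₁ ∷ [])
  ...   | no noneOutside = one w₁ vw₁ w₁≢u (neighbours⊆ _ noneOutside)
  ...   | yes (w₂ , vw₂ , w₂≢u ∷ w₂≢w₁ ∷ []) with neighbourOutside? v (u ∷ w₁ ∷ w₂ ∷ [])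
  ...     | no noneOutside =
    two w₁ w₂ vw₁ vw₂ w₁≢u w₂≢u (λ w₁≡w₂ → w₂≢w₁ (sym w₁≡w₂)) (neighbours⊆ _ noneOutside)
  ...     | yes (w₃ , vw₃ , w₃≢u ∷ w₃≢w₁ ∷ w₃≢w₂ ∷ []) =
    ⊥-elim (4≰3 (≤-trans (length≤∣∣ distinct (vw₃ ∷ vw₂ ∷ vw₁ ∷ vu ∷ [])) deg))
    where
    distinct : Unique (w₃ ∷ w₂ ∷ w₁ ∷ u ∷ [])
    distinct = (w₃≢w₂ ∷ w₃≢w₁ ∷ w₃≢u ∷ []) ∷ (w₂≢w₁ ∷ w₂≢u ∷ []) ∷ (w₁≢u ∷ []) ∷ [] ∷ []
    4≰3 : ¬ 4 ≤ 3
    4≰3 (s≤s (s≤s (s≤s ())))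

  two-neighbours⇒¬leaf : ∀ {v a b} → a ≢ b → Adj v a → Adj v b → ¬ IsLeaf v
  two-neighbours⇒¬leaf a≢b va vb isLeaf with ≤-trans (length≤∣∣ ((a≢b ∷ []) ∷ [] ∷ []) (va ∷ vb ∷ [])) isLeaf
  ... | s≤s ()

  acyclic⇒bridge : ¬ HasCycle → ∀ {u v} → Adj u v → ¬ Beyond u v u
  acyclic⇒bridge acyclic {u} {v} uv back = no-simple-return (simplify back)
    where
    open Walks (Without v u)
    linked : ∀ {a b} (w : Star (Without v u) a b) → Linked Adj (vertices w)
    linked ε = [-]
    linked (r ◅ ε) = proj₁ r ∷ [-]
    linked (r ◅ w@(_ ◅ _)) = proj₁ r ∷ linked w
    no-simple-return : Σ (Beyond u v u) Simple → ⊥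
    no-simple-return (ε , _) = irrefl u uv
    no-simple-return (r ◅ ε , _) = proj₂ r (inj₁ (refl , refl))
    no-simple-return (w@(_ ◅ _ ◅ _) , w!)
      with unique-∷ʳ⁻ (initial w) (subst Unique (vertices≡initial++last w) w!)
    ... | u∉ , initial! = acyclic (u , initial w , s≤s (s≤s z≤n) , u∉ ∷ initial! ,
                                   uv ∷ subst (Linked Adj) (vertices≡initial++last w) (linked w))

  module _ (acyclic : ¬ HasCycle) where

    Avoiding : Fin p → Fin p → Fin p → Set
    Avoiding v x y = Adj x y × x ≢ v × y ≢ v

    avoiding⇒without : ∀ {u v x y} → Avoiding v x y → Without u v x y
    avoiding⇒without (xy , x≢v , y≢v) = xy , λ { (inj₁ (_ , y≡v)) → y≢v y≡v ; (inj₂ (x≡v , _)) → x≢v x≡v }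

    avoiding-reverse : ∀ {v x y} → Avoiding v x y → Avoiding v y x
    avoiding-reverse {x = x} {y} (xy , x≢v , y≢v) = symmetric x y xy , y≢v , x≢v

    beyond⇒avoiding : ∀ {v w y} → Adj v w → Beyond v w y → Star (Avoiding v) w y
    beyond⇒avoiding {v} {w} vw = go ε
      where
      go : ∀ {c y} → Beyond v w c → Star (Without w v) c y → Star (Avoiding v) c y
      go prefix ε = ε
      go prefix (r ◅ rest) =
        (proj₁ r , (λ { refl → acyclic⇒bridge acyclic vw prefix }) ,
                   (λ { refl → acyclic⇒bridge acyclic vw (prefix ◅◅ (r ◅ ε)) }))
        ◅ go (prefix ◅◅ (r ◅ ε)) rest

    beyond-step : ∀ {u v w y} → Adj u v → Adj v w → w ≢ u → Beyond v w y → Beyond u v y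
    beyond-step {u} {v} uv vw w≢u beyond =
      (vw , λ { (inj₁ (_ , w≡u)) → w≢u w≡u ; (inj₂ (refl , _)) → irrefl v uv })
      ◅ Star.map (λ a → without-swap (avoiding⇒without a))
          (beyond⇒avoiding vw beyond)

    beyond-split : ∀ {u v y} → Beyond u v y → y ≡ v ⊎ ∃ λ w → Adj v w × w ≢ u × Beyond v w y
    beyond-split {u} {v} = go (inj₁ refl)
      where
      State : Fin p → Set
      State a = a ≡ v ⊎ ∃ λ w → Adj v w × w ≢ u × Beyond v w a
      extend : ∀ {a c} → State a → Without v u a c → State c
      extend {c = c} (inj₁ refl) (vc , ¬vu) = inj₂ (c , vc , (λ c≡u → ¬vu (inj₁ (refl , c≡u))) , ε)
      extend {a} {c} (inj₂ (w , vw , w≢u , beyond)) (ac , _)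
        with (a ≟ᶠ w) ×-dec (c ≟ᶠ v) | (a ≟ᶠ v) ×-dec (c ≟ᶠ w)
      ... | yes (_ , c≡v) | _ = inj₁ c≡v
      ... | no _ | yes (_ , refl) = inj₂ (w , vw , w≢u , ε)
      ... | no ¬wv | no ¬vw =
        inj₂ (w , vw , w≢u , beyond ◅◅ ((ac , λ { (inj₁ e) → ¬wv e ; (inj₂ e) → ¬vw e }) ◅ ε))
      go : ∀ {a y} → State a → Star (Without v u) a y → State y
      go state ε = state
      go state (r ◅ rest) = go (extend state r) rest

    beyond-disjoint : ∀ {v w₁ w₂ y} → Adj v w₁ → Adj v w₂ → w₁ ≢ w₂ → Beyond v w₁ y → Beyond v w₂ y → ⊥
    beyond-disjoint {v} {w₁} {w₂} vw₁ vw₂ w₁≢w₂ beyond₁ beyond₂ =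
      acyclic⇒bridge acyclic vw₁
        (Star.map avoiding⇒without
           (beyond⇒avoiding vw₁ beyond₁ ◅◅ Star.reverse avoiding-reverse (beyond⇒avoiding vw₂ beyond₂))
         ◅◅ (last-step ◅ ε))
      where
      last-step : Without w₁ v w₂ v
      last-step = symmetric v w₂ vw₂ , λ { (inj₁ (w₂≡w₁ , _)) → w₁≢w₂ (sym w₂≡w₁)
                                         ; (inj₂ (refl , _)) → irrefl v vw₂ }

    beyond-opposite : ∀ {u v y} → Adj u v → Beyond u v y → Beyond v u y → ⊥
    beyond-opposite uv v↝y u↝y =
      acyclic⇒bridge acyclic uv (v↝y ◅◅ Star.reverse (λ r → without-reverse (without-swap r)) u↝y)

    Side : Fin p → Fin p → Subset p
    Side u v = select (beyond? u v)

    ∣Side∣-decreasing : ∀ {u v w} → Adj u v → Adj v w → w ≢ u → ∣ Side v w ∣ < ∣ Side u v ∣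
    ∣Side∣-decreasing {u} {v} {w} uv vw w≢u = p⊂q⇒∣p∣<∣q∣
      ( (λ y∈ → ∈-select⁺ (beyond? u v) (beyond-step uv vw w≢u (∈-select⁻ (beyond? v w) y∈)))
      , v , ∈-select⁺ (beyond? u v) ε , (λ v∈ → acyclic⇒bridge acyclic vw (∈-select⁻ (beyond? v w) v∈)))

module Borders (G : Hypergraph) where

  Ends : Subset (m G) → Fin (n G) → Set
  Ends A x = ∃ λ e → e ∈ A × x ∈ ends G e

  endsOf : Subset (m G) → Subset (n G)
  endsOf A = select (λ x → any? (λ e → e ∈? A ×-dec x ∈? ends G e))

  ∈-endsOf⁺ : ∀ {A e x} → e ∈ A → x ∈ ends G e → x ∈ endsOf A
  ∈-endsOf⁺ {A} {e} e∈A x∈e = ∈-select⁺ (λ x → any? (λ e → e ∈? A ×-dec x ∈? ends G e)) (e , e∈A , x∈e)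

  ∈-endsOf⁻ : ∀ {A x} → x ∈ endsOf A → Ends A x
  ∈-endsOf⁻ {A} = ∈-select⁻ (λ x → any? (λ e → e ∈? A ×-dec x ∈? ends G e))

  endsOf-mono : ∀ {A B} → A ⊆ B → endsOf A ⊆ endsOf B
  endsOf-mono A⊆B x∈ with ∈-endsOf⁻ x∈
  ... | e , e∈A , x∈e = ∈-endsOf⁺ (A⊆B e∈A) x∈e

  endsOf-∪ : ∀ A B → endsOf A ∪ endsOf B ≡ endsOf (A ∪ B)
  endsOf-∪ A B = ⊆-antisym
    (λ x∈ → [ endsOf-mono (p⊆p∪q B) , endsOf-mono (q⊆p∪q A B) ]′ (x∈p∪q⁻ _ _ x∈))
    (λ x∈ → let (e , e∈ , x∈e) = ∈-endsOf⁻ x∈ in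
      x∈p∪q⁺ (Data.Sum.map (λ e∈A → ∈-endsOf⁺ e∈A x∈e) (λ e∈B → ∈-endsOf⁺ e∈B x∈e) (x∈p∪q⁻ A B e∈)))

  border : Subset (m G) → Subset (n G)
  border A = endsOf A ∩ endsOf (∁ A)

  border-∁ : ∀ A → border (∁ A) ⊆ border A
  border-∁ A x∈ with x∈p∩q⁻ _ _ x∈
  ... | x∈∁A , x∈∁∁A = x∈p∩q⁺ (endsOf-mono (λ e∈ → x∉∁p⇒x∈p (x∈∁p⇒x∉p e∈)) x∈∁∁A , x∈∁A)

  border⇔cut : ∀ {P : Fin (m G) → Set} {A} → (∀ e → P e ⇔ e ∈ A) →
               ∀ x → x ∈ border A ⇔ ((∃ λ e → P e × x ∈ ends G e) × (∃ λ e → ¬ P e × x ∈ ends G e))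
  border⇔cut {A = A} P⇔A x = mk⇔ to from
    where
    to : x ∈ border A → _
    to x∈ with x∈p∩q⁻ _ _ x∈
    ... | x∈A , x∈∁A with ∈-endsOf⁻ x∈A | ∈-endsOf⁻ x∈∁A
    ...   | e , e∈A , x∈e | e′ , e′∈∁A , x∈e′ =
      (e , Equivalence.from (P⇔A e) e∈A , x∈e) ,
      (e′ , (λ Pe′ → x∈∁p⇒x∉p e′∈∁A (Equivalence.to (P⇔A e′) Pe′)) , x∈e′)
    from : _ → x ∈ border A
    from ((e , Pe , x∈e) , (e′ , ¬Pe′ , x∈e′)) =
      x∈p∩q⁺ (∈-endsOf⁺ (Equivalence.to (P⇔A e) Pe) x∈e ,
              ∈-endsOf⁺ (x∉p⇒x∈∁p (λ e′∈A → ¬Pe′ (Equivalence.from (P⇔A e′) e′∈A))) x∈e′)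

  disjoint⇒border : ∀ {A₁ A₂ x} → A₁ ∩ A₂ ≡ ∅ → x ∈ endsOf A₁ → x ∈ endsOf A₂ → x ∈ border A₁
  disjoint⇒border disjoint x∈A₁ x∈A₂ =
    x∈p∩q⁺ (x∈A₁ , endsOf-mono (λ e∈A₂ → x∉p⇒x∈∁p (λ e∈A₁ → ∩≡∅⇒disjoint disjoint e∈A₁ e∈A₂)) x∈A₂)

  child-sources : ∀ {A B I Vᵢ X X′} → B ⊆ A → I ⊆ border B → Vᵢ ∩ border A ⊆ endsOf B →
                  X′ ⊆ border A ∪ X → I ∪ (X′ ∩ Vᵢ) ⊆ border B ∪ X
  child-sources {A} {B} {I} {Vᵢ} {X} {X′} B⊆A I⊆ Vᵢ⊆ X′⊆ x∈ with x∈p∪q⁻ I (X′ ∩ Vᵢ) x∈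
  ... | inj₁ x∈I = x∈p∪q⁺ (inj₁ (I⊆ x∈I))
  ... | inj₂ x∈X′Vᵢ with x∈p∩q⁻ X′ Vᵢ x∈X′Vᵢ
  ...   | x∈X′ , x∈Vᵢ with x∈p∪q⁻ (border A) X (X′⊆ x∈X′)
  ...     | inj₂ x∈X = x∈p∪q⁺ (inj₂ x∈X)
  ...     | inj₁ x∈∂A = x∈p∪q⁺ (inj₁ (x∈p∩q⁺ (Vᵢ⊆ (x∈p∩q⁺ (x∈Vᵢ , x∈∂A)) ,
              endsOf-mono (λ e∉A → x∉p⇒x∈∁p (λ e∈B → x∈∁p⇒x∉p e∉A (B⊆A e∈B))) (proj₂ (x∈p∩q⁻ _ _ x∈∂A)))))

  ∉border-full : ∀ {x} → x ∉ border full
  ∉border-full x∈ with ∈-endsOf⁻ (proj₂ (x∈p∩q⁻ _ _ x∈))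
  ... | e , e∈∁full , _ = x∈∁p⇒x∉p e∈∁full ∈⊤

  ∣border-full∣≡0 : ∣ border full ∣ ≡ 0
  ∣border-full∣≡0 = trans (cong ∣_∣ (Empty-unique (λ (_ , x∈) → ∉border-full x∈))) (∣⊥∣≡0 (n G))

  record Split (V : Subset (n G)) (A : Subset (m G)) : Set where
    field
      V₁ V₂    : Subset (n G)
      A₁ A₂    : Subset (m G)
      ends₁    : ∀ e → e ∈ A₁ → ends G e ⊆ V₁
      ends₂    : ∀ e → e ∈ A₂ → ends G e ⊆ V₂
      disjoint : A₁ ∩ A₂ ≡ ∅
      edges    : A₁ ∪ A₂ ≡ A
      vertices : V₁ ∪ V₂ ≡ V
      shared   : ∀ {x} → x ∈ V₁ → x ∈ V₂ → x ∈ endsOf A₁ × x ∈ endsOf A₂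
      border₁  : V₁ ∩ border A ⊆ endsOf A₁
      border₂  : V₂ ∩ border A ⊆ endsOf A₂

    child-sources₁ : ∀ {X X′} → X′ ⊆ border A ∪ X → (V₁ ∩ V₂) ∪ (X′ ∩ V₁) ⊆ border A₁ ∪ X
    child-sources₁ = child-sources (λ e∈ → subst (_ ∈_) edges (x∈p∪q⁺ (inj₁ e∈)))
      (λ x∈ → let (x∈V₁ , x∈V₂) = x∈p∩q⁻ V₁ V₂ x∈ ; (x∈A₁ , x∈A₂) = shared x∈V₁ x∈V₂ in
        disjoint⇒border disjoint x∈A₁ x∈A₂)
      border₁

    child-sources₂ : ∀ {X X′} → X′ ⊆ border A ∪ X → (V₁ ∩ V₂) ∪ (X′ ∩ V₂) ⊆ border A₂ ∪ X
    child-sources₂ = child-sources (λ e∈ → subst (_ ∈_) edges (x∈p∪q⁺ (inj₂ e∈)))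
      (λ x∈ → let (x∈V₁ , x∈V₂) = x∈p∩q⁻ V₁ V₂ x∈ ; (x∈A₁ , x∈A₂) = shared x∈V₁ x∈V₂ in
        disjoint⇒border (trans (∩-comm A₂ A₁) disjoint) x∈A₂ x∈A₁)
      border₂

module FromBranchDecomposition (G : Hypergraph) (D : BranchDecomposition G) (X : Subset (n G))
                               (β : ℕ) (width : WidthLE D β) where

  open BranchDecomposition D
  open Graph Y
  open Borders G

  acyclic : ¬ HasCycle
  acyclic = proj₂ (proj₂ isTree)

  leafOf-isLeaf : ∀ e → IsLeaf (leafOf e)
  leafOf-isLeaf e = proj₂ (Inverse.from b e)

  edgeAt : ∀ v → IsLeaf v → Fin (m G)
  edgeAt v isLeaf = Inverse.to b (v , isLeaf)

  edgeAt-leafOf : ∀ {e v} (isLeaf : IsLeaf v) → leafOf e ≡ v → edgeAt v isLeaf ≡ e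
  edgeAt-leafOf {e} isLeaf refl =
    trans (cong (edgeAt (leafOf e)) (≤-irrelevant isLeaf (leafOf-isLeaf e))) (Inverse.strictlyInverseˡ b e)

  leafOf-edgeAt : ∀ v (isLeaf : IsLeaf v) → leafOf (edgeAt v isLeaf) ≡ v
  leafOf-edgeAt v isLeaf = cong proj₁ (Inverse.strictlyInverseʳ b (v , isLeaf))

  leafOf-injective : ∀ {e₁ e₂} → leafOf e₁ ≡ leafOf e₂ → e₁ ≡ e₂
  leafOf-injective {e₂ = e₂} eq =
    trans (sym (edgeAt-leafOf (leafOf-isLeaf e₂) eq)) (edgeAt-leafOf (leafOf-isLeaf e₂) refl)

  EdgesBeyond : Fin p → Fin p → Subset (m G)
  EdgesBeyond u v = select (λ e → beyond? u v (leafOf e))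

  ∈-EdgesBeyond⁺ : ∀ {u v e} → Beyond u v (leafOf e) → e ∈ EdgesBeyond u v
  ∈-EdgesBeyond⁺ {u} {v} = ∈-select⁺ (λ e → beyond? u v (leafOf e))

  ∈-EdgesBeyond⁻ : ∀ {u v e} → e ∈ EdgesBeyond u v → Beyond u v (leafOf e)
  ∈-EdgesBeyond⁻ {u} {v} = ∈-select⁻ (λ e → beyond? u v (leafOf e))

  ∣border-EdgesBeyond∣≤β : ∀ {u v} → Adj u v → ∣ border (EdgesBeyond u v) ∣ ≤ β
  ∣border-EdgesBeyond∣≤β {u} {v} uv =
    width v u (symmetric u v uv) _ (border⇔cut (λ e → mk⇔ ∈-EdgesBeyond⁺ ∈-EdgesBeyond⁻))

  EdgesBeyond-leaf : ∀ {u v} → Adj u v → (∀ {z} → Adj v z → z ∈ₗ u ∷ []) → ∣ EdgesBeyond u v ∣ ≡ 1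
  EdgesBeyond-leaf {u} {v} uv only = trans (cong ∣_∣ EdgesBeyond≡) (∣⁅x⁆∣≡1 (edgeAt v isLeaf))
    where
    isLeaf : IsLeaf v
    isLeaf = ≤-trans (p⊆q⇒∣p∣≤∣q∣ (λ z∈ → subst (_∈ ⁅ u ⁆) (sym (single (only z∈))) (x∈⁅x⁆ u)))
                     (≤-reflexive (∣⁅x⁆∣≡1 u))
      where
      single : ∀ {z} → z ∈ₗ u ∷ [] → z ≡ u
      single (here z≡u) = z≡u
    stuck : ∀ {y} → Beyond u v y → y ≡ v
    stuck ε = refl
    stuck ((vc , ¬vu) ◅ _) with only vc
    ... | here refl = ⊥-elim (¬vu (inj₁ (refl , refl)))
    EdgesBeyond≡ : EdgesBeyond u v ≡ ⁅ edgeAt v isLeaf ⁆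
    EdgesBeyond≡ = ⊆-antisym
      (λ e∈ → subst (_∈ ⁅ edgeAt v isLeaf ⁆) (edgeAt-leafOf isLeaf (stuck (∈-EdgesBeyond⁻ e∈))) (x∈⁅x⁆ _))
      (λ e∈ → ∈-EdgesBeyond⁺ (subst (Beyond u v)
                (sym (trans (cong leafOf (x∈⁅y⁆⇒x≡y _ e∈)) (leafOf-edgeAt v isLeaf))) ε))

  EdgesBeyond-step : ∀ {u v w} → Adj u v → Adj v w → w ≢ u → EdgesBeyond v w ⊆ EdgesBeyond u v
  EdgesBeyond-step uv vw w≢u e∈ = ∈-EdgesBeyond⁺ (beyond-step acyclic uv vw w≢u (∈-EdgesBeyond⁻ e∈))

  EdgesBeyond-split : ∀ {u v e} → ¬ IsLeaf v → e ∈ EdgesBeyond u v →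
                      ∃ λ w → Adj v w × w ≢ u × e ∈ EdgesBeyond v w
  EdgesBeyond-split {e = e} notLeaf e∈ with beyond-split acyclic (∈-EdgesBeyond⁻ e∈)
  ... | inj₁ refl = ⊥-elim (notLeaf (leafOf-isLeaf e))
  ... | inj₂ (w , vw , w≢u , beyond) = w , vw , w≢u , ∈-EdgesBeyond⁺ beyond

  EdgesBeyond-pass : ∀ {u v w} → Adj u v → Adj v w → w ≢ u → (∀ {z} → Adj v z → z ∈ₗ u ∷ w ∷ []) →
                     EdgesBeyond u v ≡ EdgesBeyond v w
  EdgesBeyond-pass {u} {v} {w} uv vw w≢u only = ⊆-antisym onward (EdgesBeyond-step uv vw w≢u)
    where
    onward : EdgesBeyond u v ⊆ EdgesBeyond v w
    onward e∈ with EdgesBeyond-split (two-neighbours⇒¬leaf (λ u≡w → w≢u (sym u≡w)) (symmetric u v uv) vw) e∈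
    ... | w′ , vw′ , w′≢u , e∈′ with only vw′
    ...   | here refl = ⊥-elim (w′≢u refl)
    ...   | there (here refl) = e∈′

  fork : ∀ {u v w₁ w₂} → Adj u v → Adj v w₁ → Adj v w₂ → w₁ ≢ u → w₂ ≢ u → w₁ ≢ w₂ →
         (∀ {z} → Adj v z → z ∈ₗ u ∷ w₁ ∷ w₂ ∷ []) → Split (endsOf (EdgesBeyond u v)) (EdgesBeyond u v)
  fork {u} {v} {w₁} {w₂} uv vw₁ vw₂ w₁≢u w₂≢u w₁≢w₂ only = record
    { V₁ = endsOf (EdgesBeyond v w₁) ; V₂ = endsOf (EdgesBeyond v w₂)
    ; A₁ = EdgesBeyond v w₁ ; A₂ = EdgesBeyond v w₂
    ; ends₁ = λ _ e∈ → ∈-endsOf⁺ e∈ ; ends₂ = λ _ e∈ → ∈-endsOf⁺ e∈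
    ; disjoint = disjoint⇒∩≡∅ (λ e∈₁ e∈₂ →
        beyond-disjoint acyclic vw₁ vw₂ w₁≢w₂ (∈-EdgesBeyond⁻ e∈₁) (∈-EdgesBeyond⁻ e∈₂))
    ; edges = edges
    ; vertices = trans (endsOf-∪ _ _) (cong endsOf edges)
    ; shared = _,_
    ; border₁ = λ x∈ → proj₁ (x∈p∩q⁻ _ _ x∈)
    ; border₂ = λ x∈ → proj₁ (x∈p∩q⁻ _ _ x∈)
    }
    where
    onward : EdgesBeyond u v ⊆ EdgesBeyond v w₁ ∪ EdgesBeyond v w₂
    onward e∈ with EdgesBeyond-split (two-neighbours⇒¬leaf w₁≢w₂ vw₁ vw₂) e∈
    ... | w′ , vw′ , w′≢u , e∈′ with only vw′
    ...   | here refl = ⊥-elim (w′≢u refl)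
    ...   | there (here refl) = x∈p∪q⁺ (inj₁ e∈′)
    ...   | there (there (here refl)) = x∈p∪q⁺ (inj₂ e∈′)
    edges : EdgesBeyond v w₁ ∪ EdgesBeyond v w₂ ≡ EdgesBeyond u v
    edges = ⊆-antisym
      (λ e∈ → [ EdgesBeyond-step uv vw₁ w₁≢u , EdgesBeyond-step uv vw₂ w₂≢u ]′ (x∈p∪q⁻ _ _ e∈))
      onward

  Small : Subset (n G) → Subset (m G) → Subset (n G) → Set
  Small V A X′ = Σ (IBD G V A X′) (λ T → wd G T ≤ β + ∣ X ∣)

  ∣sources∣≤ : ∀ {A X′} → X′ ⊆ border A ∪ X → ∣ border A ∣ ≤ β → ∣ X′ ∣ ≤ β + ∣ X ∣
  ∣sources∣≤ {A} X′⊆ bound =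
    ≤-trans (p⊆q⇒∣p∣≤∣q∣ X′⊆) (≤-trans (∣p∪q∣≤∣p∣+∣q∣ (border A) X) (+-monoˡ-≤ ∣ X ∣ bound))

  small-leaf : ∀ {V A X′} → ∣ A ∣ ≡ 1 → ∣ border A ∣ ≤ β → X′ ⊆ border A ∪ X → Small V A X′
  small-leaf ∣A∣≡1 bound X′⊆ = leaf ∣A∣≡1 , ∣sources∣≤ X′⊆ bound

  small-node : ∀ {V A X′} (s : Split V A) → ∣ border A ∣ ≤ β → X′ ⊆ border A ∪ X →
               (∀ {X₁} → X₁ ⊆ border (Split.A₁ s) ∪ X → Small (Split.V₁ s) (Split.A₁ s) X₁) →
               (∀ {X₂} → X₂ ⊆ border (Split.A₂ s) ∪ X → Small (Split.V₂ s) (Split.A₂ s) X₂) →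
               Small V A X′
  small-node {X′ = X′} s bound X′⊆ small₁ small₂ =
    node V₁ A₁ V₂ A₂ ends₁ ends₂ disjoint edges vertices (proj₁ child₁) (proj₁ child₂) ,
    ⊔-lub (⊔-lub (proj₂ child₁) (proj₂ child₂)) (∣sources∣≤ X′⊆ bound)
    where
    open Split s
    child₁ : Small V₁ A₁ ((V₁ ∩ V₂) ∪ (X′ ∩ V₁))
    child₁ = small₁ (child-sources₁ X′⊆)
    child₂ : Small V₂ A₂ ((V₁ ∩ V₂) ∪ (X′ ∩ V₂))
    child₂ = small₂ (child-sources₂ X′⊆)

  smaller : ∀ {k u v w} → Adj u v → ∣ Side acyclic u v ∣ ≤ suc k → Adj v w → w ≢ u → ∣ Side acyclic v w ∣ ≤ k
  smaller uv size vw w≢u with ≤-trans (∣Side∣-decreasing acyclic uv vw w≢u) size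
  ... | s≤s ∣Side∣≤k = ∣Side∣≤k

  ibdBeyond : ∀ k {u v} → Adj u v → ∣ Side acyclic u v ∣ ≤ k → ∀ {X′} → X′ ⊆ border (EdgesBeyond u v) ∪ X →
              Small (endsOf (EdgesBeyond u v)) (EdgesBeyond u v) X′
  ibdBeyond zero {u} {v} uv size with ≤-trans (length≤∣∣ ([] ∷ []) (∈-select⁺ (beyond? u v) ε ∷ [])) size
  ... | ()
  ibdBeyond (suc k) {u} {v} uv size {X′} X′⊆ with otherNeighbours (symmetric u v uv) (subcubic v)
  ... | none only = small-leaf (EdgesBeyond-leaf uv only) (∣border-EdgesBeyond∣≤β uv) X′⊆
  ... | one w vw w≢u only =
    subst (λ A → X′ ⊆ border A ∪ X → Small (endsOf A) A X′) (sym (EdgesBeyond-pass uv vw w≢u only))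
      (ibdBeyond k vw (smaller uv size vw w≢u)) X′⊆
  ... | two w₁ w₂ vw₁ vw₂ w₁≢u w₂≢u w₁≢w₂ only =
    small-node (fork uv vw₁ vw₂ w₁≢u w₂≢u w₁≢w₂ only) (∣border-EdgesBeyond∣≤β uv) X′⊆
      (ibdBeyond k vw₁ (smaller uv size vw₁ w₁≢u)) (ibdBeyond k vw₂ (smaller uv size vw₂ w₂≢u))

  sole-neighbour : ∀ {e₀ e₁} → e₀ ≢ e₁ → ∃ λ s → Adj (leafOf e₀) s × (∀ {z} → Adj (leafOf e₀) z → z ∈ₗ s ∷ [])
  sole-neighbour {e₀} {e₁} e₀≢e₁
    with first-step (proj₁ (proj₂ isTree) (leafOf e₀) (leafOf e₁)) (λ eq → e₀≢e₁ (leafOf-injective eq))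
  ... | s , rs = s , rs , only
    where
    only : ∀ {z} → Adj (leafOf e₀) z → z ∈ₗ s ∷ []
    only {z} rz with z ≟ᶠ s
    ... | yes z≡s = here z≡s
    ... | no z≢s = ⊥-elim (two-neighbours⇒¬leaf z≢s rz rs (leafOf-isLeaf e₀))

  -- V₁ also receives the vertices on no edge, so that V₁ ∪ V₂ covers every vertex.
  halves : ∀ {r s} → Adj r s → Split full full
  halves {r} {s} rs = record
    { V₁ = ∁ (endsOf (EdgesBeyond r s)) ∪ endsOf (EdgesBeyond s r) ; V₂ = endsOf (EdgesBeyond r s)
    ; A₁ = EdgesBeyond s r ; A₂ = EdgesBeyond r s
    ; ends₁ = λ _ e∈ x∈ → x∈p∪q⁺ (inj₂ (∈-endsOf⁺ e∈ x∈))
    ; ends₂ = λ _ e∈ x∈ → ∈-endsOf⁺ e∈ x∈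
    ; disjoint = disjoint⇒∩≡∅ (λ e∈₁ e∈₂ →
        beyond-opposite acyclic (symmetric r s rs) (∈-EdgesBeyond⁻ e∈₁) (∈-EdgesBeyond⁻ e∈₂))
    ; edges = ⊆-antisym (λ _ → ∈⊤) (λ {e} _ → x∈p∪q⁺ (Data.Sum.map ∈-EdgesBeyond⁺ ∈-EdgesBeyond⁺
                                                      (edge-sides (proj₁ (proj₂ isTree)) r s (leafOf e))))
    ; vertices = ⊆-antisym (λ _ → ∈⊤) (λ {x} _ → x∈p∪q⁺ (on-a-side x))
    ; shared = λ x∈₁ x∈₂ → [ (λ x∉ → ⊥-elim (x∈∁p⇒x∉p x∉ x∈₂)) , (λ x∈ → x∈ , x∈₂) ]′ (x∈p∪q⁻ _ _ x∈₁)
    ; border₁ = λ x∈ → ⊥-elim (∉border-full (proj₂ (x∈p∩q⁻ _ _ x∈)))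
    ; border₂ = λ x∈ → ⊥-elim (∉border-full (proj₂ (x∈p∩q⁻ _ _ x∈)))
    }
    where
    on-a-side : ∀ x → x ∈ ∁ (endsOf (EdgesBeyond r s)) ∪ endsOf (EdgesBeyond s r)
                    ⊎ x ∈ endsOf (EdgesBeyond r s)
    on-a-side x with x ∈? endsOf (EdgesBeyond r s)
    ... | yes x∈ = inj₂ x∈
    ... | no x∉ = inj₁ (x∈p∪q⁺ (inj₁ (x∉p⇒x∈∁p x∉)))

  -- Root Y at the leaf r of e₀: its neighbour s splits the edges into {e₀} and those beyond s.
  inductiveDecomposition : ∀ {e₀ e₁} → e₀ ≢ e₁ → Small full full X
  inductiveDecomposition {e₀} e₀≢e₁ with sole-neighbour e₀≢e₁
  ... | s , rs , only =
    small-node (halves rs) (≤-trans (≤-reflexive ∣border-full∣≡0) z≤n) (λ x∈X → x∈p∪q⁺ (inj₂ x∈X))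
      (small-leaf (EdgesBeyond-leaf (symmetric _ s rs) only) (∣border-EdgesBeyond∣≤β (symmetric _ s rs)))
      (ibdBeyond p rs (∣p∣≤n (Side acyclic (leafOf e₀) s)))

module BinaryTrees (m : ℕ) where

  data Tree : Set where
    tip  : Fin m → Tree
    fork : Tree → Tree → Tree

  leaves : Tree → Subset m
  leaves (tip e) = ⁅ e ⁆
  leaves (fork l r) = leaves l ∪ leaves r

  LeavesDisjoint : Tree → Set
  LeavesDisjoint (tip _) = ⊤
  LeavesDisjoint (fork l r) = leaves l ∩ leaves r ≡ ∅ × LeavesDisjoint l × LeavesDisjoint r

  data Pos : Tree → Set where
    root  : ∀ {t} → Pos t
    left  : ∀ {l r} → Pos l → Pos (fork l r)
    right : ∀ {l r} → Pos r → Pos (fork l r)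

  subtree : (t : Tree) → Pos t → Tree
  subtree t root = t
  subtree (fork l r) (left q) = subtree l q
  subtree (fork l r) (right q) = subtree r q

  data Parent : ∀ {t} → Pos t → Pos t → Set where
    root↙ : ∀ {l r} → Parent {fork l r} root (left root)
    root↘ : ∀ {l r} → Parent {fork l r} root (right root)
    left  : ∀ {l r} {a b : Pos l} → Parent a b → Parent {fork l r} (left a) (left b)
    right : ∀ {l r} {a b : Pos r} → Parent a b → Parent {fork l r} (right a) (right b)

  data _≼_ : ∀ {t} → Pos t → Pos t → Set where
    root≼ : ∀ {t} {q : Pos t} → root ≼ q
    left  : ∀ {l r} {a b : Pos l} → a ≼ b → _≼_ {fork l r} (left a) (left b)
    right : ∀ {l r} {a b : Pos r} → a ≼ b → _≼_ {fork l r} (right a) (right b)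

  module _ {t : Tree} where

    Link : Pos t → Pos t → Set
    Link a b = Parent a b ⊎ Parent b a

    LinkWithout : Pos t → Pos t → Pos t → Pos t → Set
    LinkWithout u v a b = Link a b × ¬ ((a ≡ u × b ≡ v) ⊎ (a ≡ v × b ≡ u))

    linkWithout-swap : ∀ {u v a b} → LinkWithout u v a b → LinkWithout v u a b
    linkWithout-swap (ab , ¬uv) = ab , λ { (inj₁ e) → ¬uv (inj₂ e) ; (inj₂ e) → ¬uv (inj₁ e) }

  parent? : ∀ {t} (a b : Pos t) → Dec (Parent a b)
  parent? root root = no λ ()
  parent? root (left root) = yes root↙
  parent? root (left (left _)) = no λ ()
  parent? root (left (right _)) = no λ ()
  parent? root (right root) = yes root↘
  parent? root (right (left _)) = no λ ()
  parent? root (right (right _)) = no λ ()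
  parent? (left a) root = no λ ()
  parent? (left a) (left b) = Relation.Nullary.Decidable.map′ left (λ { (left ab) → ab }) (parent? a b)
  parent? (left a) (right b) = no λ ()
  parent? (right a) root = no λ ()
  parent? (right a) (left b) = no λ ()
  parent? (right a) (right b) = Relation.Nullary.Decidable.map′ right (λ { (right ab) → ab }) (parent? a b)

  parent-unique : ∀ {t} {a b c : Pos t} → Parent a b → Parent c b → a ≡ c
  parent-unique root↙ root↙ = refl
  parent-unique root↘ root↘ = refl
  parent-unique (left ab) (left cb) = cong left (parent-unique ab cb)
  parent-unique (right ab) (right cb) = cong right (parent-unique ab cb)

  ≼-refl : ∀ {t} {a : Pos t} → a ≼ a
  ≼-refl {a = root} = root≼
  ≼-refl {a = left a} = left ≼-refl
  ≼-refl {a = right a} = right ≼-refl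

  ≼-trans : ∀ {t} {a b c : Pos t} → a ≼ b → b ≼ c → a ≼ c
  ≼-trans root≼ _ = root≼
  ≼-trans (left ab) (left bc) = left (≼-trans ab bc)
  ≼-trans (right ab) (right bc) = right (≼-trans ab bc)

  parent⇒≼ : ∀ {t} {a b : Pos t} → Parent a b → a ≼ b
  parent⇒≼ root↙ = root≼
  parent⇒≼ root↘ = root≼
  parent⇒≼ (left ab) = left (parent⇒≼ ab)
  parent⇒≼ (right ab) = right (parent⇒≼ ab)

  parent⇒⋡ : ∀ {t} {a b : Pos t} → Parent a b → ¬ b ≼ a
  parent⇒⋡ (left ab) (left ba) = parent⇒⋡ ab ba
  parent⇒⋡ (right ab) (right ba) = parent⇒⋡ ab ba

  ≼-parent : ∀ {t} {a b c : Pos t} → Parent a b → c ≼ b → b ≡ c ⊎ c ≼ a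
  ≼-parent _ root≼ = inj₂ root≼
  ≼-parent root↙ (left root≼) = inj₁ refl
  ≼-parent root↘ (right root≼) = inj₁ refl
  ≼-parent (left ab) (left cb) = Data.Sum.map (cong left) left (≼-parent ab cb)
  ≼-parent (right ab) (right cb) = Data.Sum.map (cong right) right (≼-parent ab cb)

  ≼⇒descent : ∀ {t} {a b : Pos t} → a ≼ b → Star Parent a b
  ≼⇒descent {b = root} root≼ = ε
  ≼⇒descent {b = left b} root≼ = root↙ ◅ Star.gmap left left (≼⇒descent (root≼ {q = b}))
  ≼⇒descent {b = right b} root≼ = root↘ ◅ Star.gmap right right (≼⇒descent (root≼ {q = b}))
  ≼⇒descent (left ab) = Star.gmap left left (≼⇒descent ab)
  ≼⇒descent (right ab) = Star.gmap right right (≼⇒descent ab)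

  descent⇒≼ : ∀ {t} {a b : Pos t} → Star Parent a b → a ≼ b
  descent⇒≼ ε = ≼-refl
  descent⇒≼ (ab ◅ rest) = ≼-trans (parent⇒≼ ab) (descent⇒≼ rest)

  module Sides {t : Tree} {u v : Pos t} (uv : Parent u v) where

    linkWithout-reverse : ∀ {a b} → LinkWithout u v a b → LinkWithout u v b a
    linkWithout-reverse (ab , ¬uv) =
      Data.Sum.swap ab , λ { (inj₁ (b≡u , a≡v)) → ¬uv (inj₂ (a≡v , b≡u))
                           ; (inj₂ (b≡v , a≡u)) → ¬uv (inj₁ (a≡u , b≡v)) }

    from-child : ∀ {q} → Star (LinkWithout u v) v q → v ≼ q
    from-child = go ≼-refl
      where
      go : ∀ {a q} → v ≼ a → Star (LinkWithout u v) a q → v ≼ q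
      go va ε = va
      go va ((inj₁ ac , _) ◅ rest) = go (≼-trans va (parent⇒≼ ac)) rest
      go va ((inj₂ ca , ¬uv) ◅ rest) with ≼-parent ca va
      ... | inj₂ vc = go vc rest
      ... | inj₁ refl = ⊥-elim (¬uv (inj₂ (refl , parent-unique ca uv)))

    to-child-side : ∀ {q} → v ≼ q → Star (LinkWithout u v) v q
    to-child-side vq = go ≼-refl (≼⇒descent vq)
      where
      go : ∀ {a q} → v ≼ a → Star Parent a q → Star (LinkWithout u v) a q
      go va ε = ε
      go va (ac ◅ rest) =
        (inj₁ ac , λ { (inj₁ (refl , _)) → parent⇒⋡ uv va ; (inj₂ (refl , refl)) → parent⇒⋡ uv (parent⇒≼ ac) })
        ◅ go (≼-trans va (parent⇒≼ ac)) rest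

    from-parent : ∀ {q} → Star (LinkWithout u v) u q → ¬ v ≼ q
    from-parent = go (parent⇒⋡ uv)
      where
      extend : ∀ {a c} → ¬ v ≼ a → LinkWithout u v a c → ¬ v ≼ c
      extend ¬va (inj₁ ac , ¬uv) vc with ≼-parent ac vc
      ... | inj₂ va = ¬va va
      ... | inj₁ refl = ¬uv (inj₁ (parent-unique ac uv , refl))
      extend ¬va (inj₂ ca , _) vc = ¬va (≼-trans vc (parent⇒≼ ca))
      go : ∀ {a q} → ¬ v ≼ a → Star (LinkWithout u v) a q → ¬ v ≼ q
      go ¬va ε = ¬va
      go ¬va (r ◅ rest) = go (extend ¬va r) rest

    to-parent-side : ∀ {q} → ¬ v ≼ q → Star (LinkWithout u v) u q
    to-parent-side {q} ¬vq =
      Star.reverse linkWithout-reverse (clear-descent (≼⇒descent root≼) (λ zu → away (parent⇒⋡ uv) zu))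
      ◅◅ clear-descent (≼⇒descent root≼) (away ¬vq)
      where
      away : ∀ {b z} → ¬ v ≼ b → z ≼ b → z ≢ v
      away ¬vb zb refl = ¬vb zb
      clear-descent : ∀ {a b} → Star Parent a b → (∀ {z} → z ≼ b → z ≢ v) → Star (LinkWithout u v) a b
      clear-descent ε _ = ε
      clear-descent (ac ◅ rest) clear =
        (inj₁ ac , λ { (inj₁ (_ , c≡v)) → clear (descent⇒≼ rest) c≡v
                     ; (inj₂ (a≡v , _)) → clear (descent⇒≼ (ac ◅ rest)) a≡v })
        ◅ clear-descent rest clear

  leaves-subtree⊆ : ∀ t q → leaves (subtree t q) ⊆ leaves t
  leaves-subtree⊆ t root e∈ = e∈
  leaves-subtree⊆ (fork l r) (left q) e∈ = x∈p∪q⁺ (inj₁ (leaves-subtree⊆ l q e∈))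
  leaves-subtree⊆ (fork l r) (right q) e∈ = x∈p∪q⁺ (inj₂ (leaves-subtree⊆ r q e∈))

  tip∈leaves : ∀ t q {e} → subtree t q ≡ tip e → e ∈ leaves t
  tip∈leaves t q {e} eq = leaves-subtree⊆ t q (subst (λ s → e ∈ leaves s) (sym eq) (x∈⁅x⁆ e))

  tip-position : ∀ t {e} → e ∈ leaves t → ∃ λ q → subtree t q ≡ tip e
  tip-position (tip e′) e∈ rewrite x∈⁅y⁆⇒x≡y e′ e∈ = root , refl
  tip-position (fork l r) e∈ with x∈p∪q⁻ (leaves l) (leaves r) e∈
  ... | inj₁ e∈l = let (q , eq) = tip-position l e∈l in left q , eq
  ... | inj₂ e∈r = let (q , eq) = tip-position r e∈r in right q , eq

  tip-position-unique : ∀ t → LeavesDisjoint t → ∀ {e} (q₁ q₂ : Pos t) →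
                        subtree t q₁ ≡ tip e → subtree t q₂ ≡ tip e → q₁ ≡ q₂
  tip-position-unique (tip _) _ root root _ _ = refl
  tip-position-unique (fork l r) _ root (left _) () _
  tip-position-unique (fork l r) _ root (right _) () _
  tip-position-unique (fork l r) _ (left _) root _ ()
  tip-position-unique (fork l r) _ (right _) root _ ()
  tip-position-unique (fork l r) (_ , dl , _) (left q₁) (left q₂) eq₁ eq₂ =
    cong left (tip-position-unique l dl q₁ q₂ eq₁ eq₂)
  tip-position-unique (fork l r) (_ , _ , dr) (right q₁) (right q₂) eq₁ eq₂ =
    cong right (tip-position-unique r dr q₁ q₂ eq₁ eq₂)
  tip-position-unique (fork l r) (disjoint , _) (left q₁) (right q₂) eq₁ eq₂ =
    ⊥-elim (∩≡∅⇒disjoint disjoint (tip∈leaves l q₁ eq₁) (tip∈leaves r q₂ eq₂))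
  tip-position-unique (fork l r) (disjoint , _) (right q₁) (left q₂) eq₁ eq₂ =
    ⊥-elim (∩≡∅⇒disjoint disjoint (tip∈leaves l q₂ eq₂) (tip∈leaves r q₁ eq₁))

  ∈-leaves-subtree : ∀ t → LeavesDisjoint t → ∀ {e} {q : Pos t} → subtree t q ≡ tip e →
                     ∀ v → e ∈ leaves (subtree t v) ⇔ v ≼ q
  ∈-leaves-subtree t disjoint eq v = mk⇔ (to t disjoint eq v) (from t eq)
    where
    from : ∀ t {e} {q v : Pos t} → subtree t q ≡ tip e → v ≼ q → e ∈ leaves (subtree t v)
    from t {q = q} eq root≼ = tip∈leaves t q eq
    from (fork l r) eq (left vq) = from l eq vq
    from (fork l r) eq (right vq) = from r eq vq
    to : ∀ t → LeavesDisjoint t → ∀ {e} {q : Pos t} → subtree t q ≡ tip e → ∀ v →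
         e ∈ leaves (subtree t v) → v ≼ q
    to t _ _ root _ = root≼
    to (fork l r) _ {q = root} () (left v)
    to (fork l r) _ {q = root} () (right v)
    to (fork l r) (_ , dl , _) {q = left q} eq (left v) e∈ = left (to l dl eq v e∈)
    to (fork l r) (_ , _ , dr) {q = right q} eq (right v) e∈ = right (to r dr eq v e∈)
    to (fork l r) (disjoint , _) {q = right q} eq (left v) e∈ =
      ⊥-elim (∩≡∅⇒disjoint disjoint (leaves-subtree⊆ l v e∈) (tip∈leaves r q eq))
    to (fork l r) (disjoint , _) {q = left q} eq (right v) e∈ =
      ⊥-elim (∩≡∅⇒disjoint disjoint (tip∈leaves l q eq) (leaves-subtree⊆ r v e∈))

  parentOf : ∀ {t} → Pos t → Maybe (Pos t)
  parentOf root = nothing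
  parentOf (left a) = just (maybe′ left root (parentOf a))
  parentOf (right a) = just (maybe′ right root (parentOf a))

  parentOf-parent : ∀ {t} {a b : Pos t} → Parent b a → parentOf a ≡ just b
  parentOf-parent root↙ = refl
  parentOf-parent root↘ = refl
  parentOf-parent (left ba) = cong (λ x → just (maybe′ left root x)) (parentOf-parent ba)
  parentOf-parent (right ba) = cong (λ x → just (maybe′ right root x)) (parentOf-parent ba)

  children : (t : Tree) → Pos t → List (Pos t)
  children (tip _) root = []
  children (fork _ _) root = left root ∷ right root ∷ []
  children (fork l r) (left a) = Data.List.map left (children l a)
  children (fork l r) (right a) = Data.List.map right (children r a)

  children-parent : ∀ {t} {a b : Pos t} → Parent a b → b ∈ₗ children t a
  children-parent root↙ = here refl
  children-parent root↘ = there (here refl)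
  children-parent (left ab) = ∈-map⁺ left (children-parent ab)
  children-parent (right ab) = ∈-map⁺ right (children-parent ab)

  length-children≤2 : ∀ t (a : Pos t) → length (children t a) ≤ 2
  length-children≤2 (tip _) root = z≤n
  length-children≤2 (fork _ _) root = ≤-refl
  length-children≤2 (fork l r) (left a) =
    ≤-trans (≤-reflexive (length-map left (children l a))) (length-children≤2 l a)
  length-children≤2 (fork l r) (right a) =
    ≤-trans (≤-reflexive (length-map right (children r a))) (length-children≤2 r a)

  children-tip : ∀ t (a : Pos t) {e} → subtree t a ≡ tip e → children t a ≡ []
  children-tip (tip _) root _ = refl
  children-tip (fork l r) (left a) eq = cong (Data.List.map left) (children-tip l a eq)
  children-tip (fork l r) (right a) eq = cong (Data.List.map right) (children-tip r a eq)

  neighbours : ∀ {t} → Pos t → List (Pos t)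
  neighbours {t} a = fromMaybe (parentOf a) ++ children t a

  link⇒∈neighbours : ∀ {t} {a b : Pos t} → Link a b → b ∈ₗ neighbours a
  link⇒∈neighbours {a = a} (inj₁ ab) = ∈-++⁺ʳ (fromMaybe (parentOf a)) (children-parent ab)
  link⇒∈neighbours (inj₂ ba) rewrite parentOf-parent ba = here refl

  length-neighbours : ∀ {t} (a : Pos t) →
                      length (neighbours a) ≡ length (fromMaybe (parentOf a)) + length (children t a)
  length-neighbours a = length-++ (fromMaybe (parentOf a))

  length-fromMaybe≤1 : ∀ {A : Set} (x : Maybe A) → length (fromMaybe x) ≤ 1
  length-fromMaybe≤1 nothing = z≤n
  length-fromMaybe≤1 (just _) = ≤-refl

  fork-children : ∀ t (a : Pos t) {l r} → subtree t a ≡ fork l r →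
                  ∃₂ λ c₁ c₂ → c₁ ≢ c₂ × Parent a c₁ × Parent a c₂
  fork-children (fork _ _) root refl = left root , right root , (λ ()) , root↙ , root↘
  fork-children (fork l _) (left a) eq with fork-children l a eq
  ... | c₁ , c₂ , c₁≢c₂ , ac₁ , ac₂ = left c₁ , left c₂ , (λ { refl → c₁≢c₂ refl }) , left ac₁ , left ac₂
  fork-children (fork _ r) (right a) eq with fork-children r a eq
  ... | c₁ , c₂ , c₁≢c₂ , ac₁ , ac₂ = right c₁ , right c₂ , (λ { refl → c₁≢c₂ refl }) , right ac₁ , right ac₂

module TreeDecomposition (G : Hypergraph) where

  open BinaryTrees (m G)
  open Borders G

  size : Tree → ℕ
  size (tip _) = 1
  size (fork l r) = suc (size l + size r)

  index : ∀ {t} → Pos t → Fin (size t)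
  index {tip _} root = zero
  index {fork _ _} root = zero
  index {fork l r} (left q) = suc (index q ↑ˡ size r)
  index {fork l r} (right q) = suc (size l ↑ʳ index q)

  position : ∀ t → Fin (size t) → Pos t
  position (tip _) _ = root
  position (fork _ _) zero = root
  position (fork l r) (suc i) =
    [ (λ j → left (position l j)) , (λ j → right (position r j)) ]′ (splitAt (size l) i)

  position-index : ∀ {t} (q : Pos t) → position t (index q) ≡ q
  position-index {tip _} root = refl
  position-index {fork _ _} root = refl
  position-index {fork l r} (left q)
    rewrite splitAt-↑ˡ (size l) (index q) (size r) = cong left (position-index q)
  position-index {fork l r} (right q)
    rewrite splitAt-↑ʳ (size l) (size r) (index q) = cong right (position-index q)

  index-position : ∀ t (i : Fin (size t)) → index (position t i) ≡ i
  index-position (tip _) zero = refl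
  index-position (fork _ _) zero = refl
  index-position (fork l r) (suc i) with splitAt (size l) i in eq
  ... | inj₁ j = cong suc (trans (cong (_↑ˡ size r) (index-position l j)) (splitAt⁻¹-↑ˡ eq))
  ... | inj₂ j = cong suc (trans (cong (size l ↑ʳ_) (index-position r j)) (splitAt⁻¹-↑ʳ eq))

  size-nonZero : ∀ t → NonZero (size t)
  size-nonZero (tip _) = Data.Nat.nonZero
  size-nonZero (fork _ _) = Data.Nat.nonZero

  module _ (t : Tree) (disjoint : LeavesDisjoint t) (covering : leaves t ≡ full) where

    pos : Fin (size t) → Pos t
    pos = position t

    pos-injective : ∀ {i j} → pos i ≡ pos j → i ≡ j
    pos-injective {i} {j} eq = trans (sym (index-position t i)) (trans (cong index eq) (index-position t j))

    link? : ∀ (a b : Pos t) → Dec (Link a b)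
    link? a b = parent? a b ⊎-dec parent? b a

    tree : SimpleGraph (size t)
    tree = record
      { nbr = λ u → select (λ v → link? (pos u) (pos v))
      ; symmetric = λ u v v∈ → ∈-select⁺ (λ w → link? (pos v) (pos w))
                                          (Data.Sum.swap (∈-select⁻ (λ w → link? (pos u) (pos w)) v∈))
      ; irrefl = λ v v∈ → [ irreflexive , irreflexive ]′ (∈-select⁻ (λ w → link? (pos v) (pos w)) v∈)
      }
      where
      irreflexive : ∀ {a : Pos t} → ¬ Parent a a
      irreflexive aa = parent⇒⋡ aa ≼-refl

    open SimpleGraph tree
    open Graph tree

    adj⇒link : ∀ {u v} → Adj u v → Link (pos u) (pos v)
    adj⇒link {u} = ∈-select⁻ (λ w → link? (pos u) (pos w))

    link⇒adj : ∀ {u v} → Link (pos u) (pos v) → Adj u v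
    link⇒adj {u} = ∈-select⁺ (λ w → link? (pos u) (pos w))

    without⇒linkWithout : ∀ {u v a b} → Without u v a b → LinkWithout (pos u) (pos v) (pos a) (pos b)
    without⇒linkWithout (ab , ¬uv) = adj⇒link ab , λ
      { (inj₁ (a≡u , b≡v)) → ¬uv (inj₁ (pos-injective a≡u , pos-injective b≡v))
      ; (inj₂ (a≡v , b≡u)) → ¬uv (inj₂ (pos-injective a≡v , pos-injective b≡u)) }

    linkWithout⇒without : ∀ {u v a b} → LinkWithout (pos u) (pos v) (pos a) (pos b) → Without u v a b
    linkWithout⇒without (ab , ¬uv) = link⇒adj ab , λ
      { (inj₁ (refl , refl)) → ¬uv (inj₁ (refl , refl))
      ; (inj₂ (refl , refl)) → ¬uv (inj₂ (refl , refl)) }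

    walk-down : ∀ u → Star Adj (index root) u
    walk-down u = star-reflect {T = Link} pos index (index-position t) position-index link⇒adj
                    (Star.map inj₁ (subst (λ a → Star Parent a (pos u)) (sym (position-index root))
                                          (≼⇒descent root≼)))

    connected : Connected
    connected u v = Star.reverse (λ {a} {b} ab → symmetric a b ab) (walk-down u) ◅◅ walk-down v

    -- A cycle would cross some edge uv of the tree without using it, which Sides rules out.
    acyclic : ¬ HasCycle
    acyclic cycle with cycle⇒non-bridge cycle
    ... | u , v , uv , back with adj⇒link uv | Star.gmap pos without⇒linkWithout back
    ...   | inj₁ pu-pv | walk = parent⇒⋡ pu-pv (Sides.from-child pu-pv (Star.map linkWithout-swap walk))
    ...   | inj₂ pv-pu | walk = Sides.from-parent pv-pu walk ≼-refl

    degree≤neighbours : ∀ u → degree u ≤ length (neighbours (pos u))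
    degree≤neighbours u =
      ≤-trans (p⊆q⇒∣p∣≤∣q∣ nbr⊆) (≤-trans (∣fromList∣≤length (Data.List.map index (neighbours (pos u))))
                                          (≤-reflexive (length-map index (neighbours (pos u)))))
      where
      nbr⊆ : nbr u ⊆ fromList (Data.List.map index (neighbours (pos u)))
      nbr⊆ {v} v∈ =
        ∈-fromList⁺ (subst (_∈ₗ _) (index-position t v) (∈-map⁺ index (link⇒∈neighbours (adj⇒link v∈))))

    subcubic : ∀ u → degree u ≤ 3
    subcubic u = ≤-trans (degree≤neighbours u) (≤-trans (≤-reflexive (length-neighbours (pos u)))
                   (+-mono-≤ (length-fromMaybe≤1 (parentOf (pos u))) (length-children≤2 t (pos u))))

    tip⇒leaf : ∀ u {e} → subtree t (pos u) ≡ tip e → IsLeaf u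
    tip⇒leaf u eq = begin
      degree u                                                         ≤⟨ degree≤neighbours u ⟩
      length (neighbours (pos u))                                      ≡⟨ length-neighbours (pos u) ⟩
      length (fromMaybe (parentOf (pos u))) + length (children t (pos u))
        ≡⟨ cong (λ cs → length (fromMaybe (parentOf (pos u))) + length cs) (children-tip t (pos u) eq) ⟩
      length (fromMaybe (parentOf (pos u))) + 0                        ≡⟨ +-identityʳ _ ⟩
      length (fromMaybe (parentOf (pos u)))                            ≤⟨ length-fromMaybe≤1 (parentOf (pos u)) ⟩
      1                                                                ∎
      where open ≤-Reasoning

    leaf⇒tip : ∀ u → IsLeaf u → ∃ λ e → subtree t (pos u) ≡ tip e
    leaf⇒tip u isLeaf with subtree t (pos u) in eq
    ... | tip e = e , refl
    ... | fork _ _ with fork-children t (pos u) eq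
    ...   | c₁ , c₂ , c₁≢c₂ , uc₁ , uc₂ = ⊥-elim (two-neighbours⇒¬leaf
              (λ i≡j → c₁≢c₂ (trans (sym (position-index c₁)) (trans (cong pos i≡j) (position-index c₂))))
              (link⇒adj (inj₁ (subst (Parent (pos u)) (sym (position-index c₁)) uc₁)))
              (link⇒adj (inj₁ (subst (Parent (pos u)) (sym (position-index c₂)) uc₂))) isLeaf)

    tipOf : ∀ e → ∃ λ q → subtree t q ≡ tip e
    tipOf e = tip-position t (subst (e ∈_) (sym covering) ∈⊤)

    leaves↔edges : Σ (Fin (size t)) IsLeaf ↔ Fin (m G)
    leaves↔edges = mk↔ₛ′ (λ (u , isLeaf) → proj₁ (leaf⇒tip u isLeaf)) leafAt label-leafAt leafAt-label
      where
      leafAt : Fin (m G) → Σ (Fin (size t)) IsLeaf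
      leafAt e =
        index (proj₁ (tipOf e)) , tip⇒leaf _ (trans (cong (subtree t) (position-index _)) (proj₂ (tipOf e)))
      label-leafAt : ∀ e → proj₁ (leaf⇒tip (proj₁ (leafAt e)) (proj₂ (leafAt e))) ≡ e
      label-leafAt e with leaf⇒tip (proj₁ (leafAt e)) (proj₂ (leafAt e))
      ... | e′ , eq with trans (sym eq) (trans (cong (subtree t) (position-index _)) (proj₂ (tipOf e)))
      ...   | refl = refl
      leafAt-label : ∀ ul → leafAt (proj₁ (leaf⇒tip (proj₁ ul) (proj₂ ul))) ≡ ul
      leafAt-label (u , isLeaf) with leaf⇒tip u isLeaf
      ... | e , eq with tip-position-unique t disjoint (proj₁ (tipOf e)) (pos u) (proj₂ (tipOf e)) eq
      ...   | q≡pos-u = Σ-≡ (trans (cong index q≡pos-u) (index-position t u))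
        where
        Σ-≡ : ∀ {v} {l : IsLeaf v} → v ≡ u → _≡_ {A = Σ (Fin (size t)) IsLeaf} (v , l) (u , isLeaf)
        Σ-≡ refl = cong (u ,_) (≤-irrelevant _ _)

    decomposition : BranchDecomposition G
    decomposition = record
      { p = size t ; Y = tree ; isTree = size-nonZero t , connected , acyclic
      ; subcubic = subcubic ; b = leaves↔edges }

    open BranchDecomposition decomposition using (InA; Cut)

    inA⇔walk : ∀ {u v} e → InA u v e ⇔ Star (LinkWithout (pos u) (pos v)) (pos u) (proj₁ (tipOf e))
    inA⇔walk {u} {v} e = mk⇔
      (λ inA → subst (Star _ (pos u)) (position-index q) (Star.gmap pos without⇒linkWithout inA))
      (λ walk → star-reflect {T = LinkWithout (pos u) (pos v)} pos index (index-position t) position-index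
                  linkWithout⇒without (subst (Star _ (pos u)) (sym (position-index q)) walk))
      where
      q : Pos t
      q = proj₁ (tipOf e)

    cut⊆border : ∀ {u v B} {S : Subset (n G)} → (∀ x → x ∈ S ⇔ Cut u v x) → (∀ e → InA u v e ⇔ e ∈ B) →
                 S ⊆ border B
    cut⊆border S⇔cut inA⇔ {x} x∈S = Equivalence.from (border⇔cut inA⇔ x) (Equivalence.to (S⇔cut x) x∈S)

    width : ∀ {k} → (∀ q → ∣ border (leaves (subtree t q)) ∣ ≤ k) → WidthLE decomposition k
    width bounded u v uv S S⇔cut with adj⇒link uv
    ... | inj₁ pu-pv =
      ≤-trans (p⊆q⇒∣p∣≤∣q∣ (λ x∈S → border-∁ _ (cut⊆border S⇔cut inA⇔∉ x∈S))) (bounded (pos v))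
      where
      inA⇔∉ : ∀ e → InA u v e ⇔ e ∈ ∁ (leaves (subtree t (pos v)))
      inA⇔∉ e = mk⇔
        (λ inA → x∉p⇒x∈∁p (λ e∈ → Sides.from-parent pu-pv (Equivalence.to (inA⇔walk e) inA)
                                     (Equivalence.to (∈-leaves-subtree t disjoint (proj₂ (tipOf e)) (pos v)) e∈)))
        (λ e∈∁ → Equivalence.from (inA⇔walk e) (Sides.to-parent-side pu-pv (λ v≼ → x∈∁p⇒x∉p e∈∁
                   (Equivalence.from (∈-leaves-subtree t disjoint (proj₂ (tipOf e)) (pos v)) v≼))))
    ... | inj₂ pv-pu = ≤-trans (p⊆q⇒∣p∣≤∣q∣ (cut⊆border S⇔cut inA⇔∈)) (bounded (pos u))
      where
      inA⇔∈ : ∀ e → InA u v e ⇔ e ∈ leaves (subtree t (pos u))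
      inA⇔∈ e = mk⇔
        (λ inA → Equivalence.from (∈-leaves-subtree t disjoint (proj₂ (tipOf e)) (pos u))
                   (Sides.from-child pv-pu (Star.map linkWithout-swap (Equivalence.to (inA⇔walk e) inA))))
        (λ e∈ → Equivalence.from (inA⇔walk e) (Star.map linkWithout-swap (Sides.to-child-side pv-pu
                  (Equivalence.to (∈-leaves-subtree t disjoint (proj₂ (tipOf e)) (pos u)) e∈))))

module FromInductive (G : Hypergraph) where

  open BinaryTrees (m G)
  open Borders G

  Closed : Subset (n G) → Subset (m G) → Subset (n G) → Set
  Closed V E X′ = (∀ e → e ∈ E → ends G e ⊆ V) × (∀ {x e} → x ∈ V → e ∉ E → x ∈ ends G e → x ∈ X′)

  border⊆sources : ∀ {V E X′} → Closed V E X′ → border E ⊆ X′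
  border⊆sources (inside , outside) x∈
    with ∈-endsOf⁻ (proj₁ (x∈p∩q⁻ _ _ x∈)) | ∈-endsOf⁻ (proj₂ (x∈p∩q⁻ _ _ x∈))
  ... | e , e∈E , x∈e | e′ , e′∈∁E , x∈e′ = outside (inside e e∈E x∈e) (x∈∁p⇒x∉p e′∈∁E) x∈e′

  child-closed : ∀ {V E X′ Vᵢ Eᵢ Vⱼ Eⱼ I} → Closed V E X′ →
                 (∀ e → e ∈ Eᵢ → ends G e ⊆ Vᵢ) → (∀ e → e ∈ Eⱼ → ends G e ⊆ Vⱼ) →
                 E ⊆ Eᵢ ∪ Eⱼ → Vᵢ ⊆ V → (∀ {x} → x ∈ Vᵢ → x ∈ Vⱼ → x ∈ I) → Closed Vᵢ Eᵢ (I ∪ (X′ ∩ Vᵢ))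
  child-closed {Eⱼ = Eⱼ} (_ , outside) insideᵢ insideⱼ E⊆ Vᵢ⊆V shared =
    insideᵢ , λ {x} {e} x∈Vᵢ e∉Eᵢ x∈e → x∈p∪q⁺ (crossing x∈Vᵢ e∉Eᵢ x∈e)
    where
    crossing : ∀ {x e} → x ∈ _ → e ∉ _ → x ∈ ends G e → x ∈ _ ⊎ x ∈ _ ∩ _
    crossing {e = e} x∈Vᵢ e∉Eᵢ x∈e with e ∈? Eⱼ
    ... | yes e∈Eⱼ = inj₁ (shared x∈Vᵢ (insideⱼ e e∈Eⱼ x∈e))
    ... | no e∉Eⱼ =
      inj₂ (x∈p∩q⁺ (outside (Vᵢ⊆V x∈Vᵢ) (λ e∈E → [ e∉Eᵢ , e∉Eⱼ ]′ (x∈p∪q⁻ _ _ (E⊆ e∈E))) x∈e , x∈Vᵢ))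

  TreeFor : Subset (m G) → ℕ → Set
  TreeFor E k = E ≡ ∅ ⊎ Σ Tree λ t → leaves t ≡ E × LeavesDisjoint t ×
                                     (∀ q → ∣ border (leaves (subtree t q)) ∣ ≤ k)

  TreeFor-mono : ∀ {E k k′} → k ≤ k′ → TreeFor E k → TreeFor E k′
  TreeFor-mono _ (inj₁ E≡∅) = inj₁ E≡∅
  TreeFor-mono k≤k′ (inj₂ (t , leaves≡ , disjoint , bounded)) =
    inj₂ (t , leaves≡ , disjoint , λ q → ≤-trans (bounded q) k≤k′)

  merge : ∀ {E₁ E₂ E k} → E₁ ∩ E₂ ≡ ∅ → E₁ ∪ E₂ ≡ E → ∣ border E ∣ ≤ k →
          TreeFor E₁ k → TreeFor E₂ k → TreeFor E k
  merge _ refl _ (inj₁ refl) (inj₁ refl) = inj₁ (∪-identityˡ ∅)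
  merge {E₂ = E₂} _ refl _ (inj₁ refl) (inj₂ (t₂ , leaves≡ , disjoint , bounded)) =
    inj₂ (t₂ , trans leaves≡ (sym (∪-identityˡ E₂)) , disjoint , bounded)
  merge {E₁ = E₁} _ refl _ (inj₂ (t₁ , leaves≡ , disjoint , bounded)) (inj₁ refl) =
    inj₂ (t₁ , trans leaves≡ (sym (∪-identityʳ E₁)) , disjoint , bounded)
  merge {k = k} E₁∩E₂≡∅ refl bound (inj₂ (t₁ , refl , disjoint₁ , bounded₁))
                                   (inj₂ (t₂ , refl , disjoint₂ , bounded₂)) =
    inj₂ (fork t₁ t₂ , refl , (E₁∩E₂≡∅ , disjoint₁ , disjoint₂) , bounded)
    where
    bounded : ∀ q → ∣ border (leaves (subtree (fork t₁ t₂) q)) ∣ ≤ k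
    bounded root = bound
    bounded (left q) = bounded₁ q
    bounded (right q) = bounded₂ q

  toTree : ∀ {V E X′} (T : IBD G V E X′) → Closed V E X′ → TreeFor E (wd G T)
  toTree (empty E≡∅) _ = inj₁ E≡∅
  toTree {E = E} (leaf ∣E∣≡1) closed with ∣p∣≡1⇒singleton {p = E} ∣E∣≡1
  ... | e , refl = inj₂ (tip e , refl , tt , λ { root → p⊆q⇒∣p∣≤∣q∣ (border⊆sources closed) })
  toTree {V} {E} {X′} (node V₁ E₁ V₂ E₂ inside₁ inside₂ disjoint edges vertices T₁ T₂) closed =
    merge disjoint edges (≤-trans (p⊆q⇒∣p∣≤∣q∣ (border⊆sources closed)) (m≤n⊔m _ ∣ X′ ∣))
      (TreeFor-mono (≤-trans (m≤m⊔n (wd G T₁) (wd G T₂)) (m≤m⊔n _ ∣ X′ ∣)) (toTree T₁ closed₁))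
      (TreeFor-mono (≤-trans (m≤n⊔m (wd G T₁) (wd G T₂)) (m≤m⊔n _ ∣ X′ ∣)) (toTree T₂ closed₂))
    where
    E⊆ : E ⊆ E₁ ∪ E₂
    E⊆ e∈ = subst (_ ∈_) (sym edges) e∈
    Vᵢ⊆V : ∀ {x} → x ∈ V₁ ⊎ x ∈ V₂ → x ∈ V
    Vᵢ⊆V x∈ = subst (_ ∈_) vertices (x∈p∪q⁺ x∈)
    closed₁ : Closed V₁ E₁ ((V₁ ∩ V₂) ∪ (X′ ∩ V₁))
    closed₁ = child-closed closed inside₁ inside₂ E⊆
                (λ x∈ → Vᵢ⊆V (inj₁ x∈)) (λ x∈V₁ x∈V₂ → x∈p∩q⁺ (x∈V₁ , x∈V₂))
    closed₂ : Closed V₂ E₂ ((V₁ ∩ V₂) ∪ (X′ ∩ V₂))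
    closed₂ = child-closed closed inside₂ inside₁ (λ e∈ → subst (_ ∈_) (∪-comm E₁ E₂) (E⊆ e∈))
                (λ x∈ → Vᵢ⊆V (inj₂ x∈)) (λ x∈V₂ x∈V₁ → x∈p∩q⁺ (x∈V₁ , x∈V₂))

edgeless⇒width0 : (G : Hypergraph) → full {m G} ≡ ∅ → (D : BranchDecomposition G) → WidthLE D 0
edgeless⇒width0 G full≡∅ D u v _ S S⇔cut =
  ≤-trans (p⊆q⇒∣p∣≤∣q∣ S⊆∅) (≤-reflexive (∣⊥∣≡0 (n G)))
  where
  S⊆∅ : S ⊆ ∅
  S⊆∅ {x} x∈S with Equivalence.to (S⇔cut x) x∈S
  ... | (e , _) , _ = ⊥-elim (∉⊥ (subst (e ∈_) full≡∅ ∈⊤))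

bwd≤wd : ∀ G X b → IsBwd G b → (T : IBD G full full X) → b ≤ wd G T
bwd≤wd G X b (minimal , attained) T with FromInductive.toTree G T ((λ _ _ _ → ∈⊤) , λ _ e∉ _ → ⊥-elim (e∉ ∈⊤))
... | inj₂ (t , covering , disjoint , bounded) =
  minimal (TreeDecomposition.decomposition G t disjoint covering) (wd G T)
          (TreeDecomposition.width G t disjoint covering bounded)
... | inj₁ full≡∅ with attained
...   | inj₂ (_ , refl) = z≤n
...   | inj₁ (D , _) = ≤-trans (minimal D 0 (edgeless⇒width0 G full≡∅ D)) z≤n

edge-count : ∀ k → k ≡ 0 ⊎ k ≡ 1 ⊎ Σ (Fin k) λ e₀ → Σ (Fin k) λ e₁ → e₀ ≢ e₁
edge-count zero = inj₁ refl
edge-count (suc zero) = inj₂ (inj₁ refl)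
edge-count (suc (suc k)) = inj₂ (inj₂ (zero , suc zero , λ ()))

ibwd≤bwd+∣X∣ : ∀ G X b → IsBwd G b → Σ (IBD G full full X) λ T → wd G T ≤ b + ∣ X ∣
ibwd≤bwd+∣X∣ G X b (_ , attained) with edge-count (m G)
... | inj₁ m≡0 = empty (subst (λ k → full {k} ≡ ∅) (sym m≡0) refl) , z≤n
... | inj₂ (inj₁ m≡1) = leaf (trans (∣⊤∣≡n (m G)) m≡1) , m≤n+m ∣ X ∣ b
... | inj₂ (inj₂ (e₀ , e₁ , e₀≢e₁)) with attained
...   | inj₁ (D , width) = FromBranchDecomposition.inductiveDecomposition G D X b width e₀≢e₁
...   | inj₂ (m≡0 , _) = ⊥-elim (¬Fin0 (subst Fin m≡0 e₀))

proposition3p19 : (G : Hypergraph) (X : Subset (n G)) (b i : ℕ) →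
    IsBwd G b → IsIbwd G X i → b ≤ i × i ≤ b + ∣ X ∣
proposition3p19 G X b i bwd ((T , wdT≡i) , minimal) =
  subst (b ≤_) wdT≡i (bwd≤wd G X b bwd T) ,
  ≤-trans (minimal (proj₁ upper)) (proj₂ upper)
  where
  upper : Σ (IBD G full full X) λ T → wd G T ≤ b + ∣ X ∣
  upper = ibwd≤bwd+∣X∣ G X b bwd
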